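{- Let $f,g\in\mathbb{Q}[t]$ be coprime polynomials of degrees $r$ and $s$, at least one positive, with $\max(r/4,s/6)=n/m$, $n,m$ coprime positive integers, and $n=1$ or $m=1$. Let $S(X)$ be the set of pairs $(A,B)\in\mathbb{Z}[i]^2$ with $4A^3+27B^2\ne0$, $\gcd(A^3,B^2)$ not divisible by the 12th power of any non-unit, $N(A)<X^{1/3}$, $N(B)<X^{1/2}$, and $A=u^4f(t)$, $B=u^6g(t)$ for some $u,t\in\mathbb{Q}[i]$. For $(a,b)\in\mathbb{Z}[i]^2$ put $u=b^n$, $t=a/b^m$, $A=u^4f(t)$, $B=u^6g(t)$. Fix $\kappa>0$ such that whenever $a,b$ are coprime with $N(a)<\kappa X^{m/12n}$ and $N(b)<\kappa X^{1/12n}$, one has $N(A)<X^{1/3}$ and $N(B)<X^{1/2}$. Let $S_2(X)$ be the set of pairs $(a,b)\in\mathbb{Z}[i]^2$ with $a,b$ coprime, $N(a)<\kappa X^{m/12n}$, $N(b)<\kappa X^{1/12n}$, and $4A^3+27B^2\ne0$; let $S_3(X)$ be the set of pairs $(A,B)\in\mathbb{Z}[i]^2$ arising from elements of $S_2(X)$; and consider the map $S_3(X)\to S(X)$ sending $(A,B)$ to $(A/d^4,B/d^6)$, where $d^{12}$ is the largest 12th power dividing $\gcd(A^3,B^2)$. Then there exists a finite positive constant $N$, independent of $X$, such that every fiber of this map has cardinality at most $N$.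
   Context: $N(z)$ denotes the norm of $z\in\mathbb{Q}[i]$.
   Formalization: The constant κ and the parameter X range over the positive rationals. -}

module Defs where

open import Data.Nat as ℕ using (ℕ; zero; suc)
open import Data.Integer as ℤ using (ℤ; +_)
open import Data.Rational as ℚ using (ℚ)
open import Data.Product using (_×_; _,_; ∃; Σ)
open import Data.List using (List; []; _∷_; length)
open import Relation.Binary.PropositionalEquality using (_≡_; _≢_)

-- Polynomials over ℚ: coefficient lists, lowest degree first.

Poly : Set
Poly = List ℚ

coeff : Poly → ℕ → ℚ
coeff []       _       = ℚ.0ℚ
coeff (c ∷ _)  zero    = c
coeff (_ ∷ cs) (suc k) = coeff cs k

HasDegree : Poly → ℕ → Set
HasDegree f r = (coeff f r ≢ ℚ.0ℚ) × (∀ k → r ℕ.< k → coeff f k ≡ ℚ.0ℚ)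

_+ₚ_ : Poly → Poly → Poly
[]       +ₚ q        = q
p        +ₚ []       = p
(a ∷ p)  +ₚ (b ∷ q)  = (a ℚ.+ b) ∷ (p +ₚ q)

scaleₚ : ℚ → Poly → Poly
scaleₚ c []       = []
scaleₚ c (a ∷ p)  = (c ℚ.* a) ∷ scaleₚ c p

_*ₚ_ : Poly → Poly → Poly
[]      *ₚ q = []
(a ∷ p) *ₚ q = scaleₚ a q +ₚ (ℚ.0ℚ ∷ (p *ₚ q))

-- divisibility in ℚ[t] (equality of polynomials = equality of all coefficients)
_∣ₚ_ : Poly → Poly → Set
p ∣ₚ f = ∃ λ q → ∀ k → coeff (q *ₚ p) k ≡ coeff f k

IsUnitₚ : Poly → Set
IsUnitₚ p = (coeff p 0 ≢ ℚ.0ℚ) × (∀ k → 0 ℕ.< k → coeff p k ≡ ℚ.0ℚ)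

CoprimeP : Poly → Poly → Set
CoprimeP f g = ∀ p → p ∣ₚ f → p ∣ₚ g → IsUnitₚ p

-- Gaussian integers ℤ[i] and Gaussian rationals ℚ[i], as pairs (re , im).

ℤi : Set
ℤi = ℤ × ℤ

ℚi : Set
ℚi = ℚ × ℚ

infixl 6 _+ᵢ_ _+q_
infixl 7 _*ᵢ_ _*q_
infixr 8 _^ᵢ_ _^q_

_+ᵢ_ : ℤi → ℤi → ℤi
(a , b) +ᵢ (c , d) = (a ℤ.+ c , b ℤ.+ d)

_*ᵢ_ : ℤi → ℤi → ℤi
(a , b) *ᵢ (c , d) = (a ℤ.* c ℤ.- b ℤ.* d , a ℤ.* d ℤ.+ b ℤ.* c)

0ᵢ 1ᵢ : ℤi
0ᵢ = (+ 0 , + 0)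
1ᵢ = (+ 1 , + 0)

ofℤ : ℤ → ℤi
ofℤ k = (k , + 0)

_^ᵢ_ : ℤi → ℕ → ℤi
z ^ᵢ zero  = 1ᵢ
z ^ᵢ suc k = z *ᵢ (z ^ᵢ k)

Nᵢ : ℤi → ℕ
Nᵢ (a , b) = ℤ.∣ a ∣ ℕ.* ℤ.∣ a ∣ ℕ.+ ℤ.∣ b ∣ ℕ.* ℤ.∣ b ∣

_∣ᵢ_ : ℤi → ℤi → Set
d ∣ᵢ z = ∃ λ q → q *ᵢ d ≡ z

IsUnitᵢ : ℤi → Set
IsUnitᵢ u = Nᵢ u ≡ 1

CoprimeI : ℤi → ℤi → Set
CoprimeI a b = ∀ e → e ∣ᵢ a → e ∣ᵢ b → IsUnitᵢ e

_+q_ : ℚi → ℚi → ℚi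
(a , b) +q (c , d) = (a ℚ.+ c , b ℚ.+ d)

_*q_ : ℚi → ℚi → ℚi
(a , b) *q (c , d) = (a ℚ.* c ℚ.- b ℚ.* d , a ℚ.* d ℚ.+ b ℚ.* c)

0q 1q : ℚi
0q = (ℚ.0ℚ , ℚ.0ℚ)
1q = (ℚ.1ℚ , ℚ.0ℚ)

_^q_ : ℚi → ℕ → ℚi
z ^q zero  = 1q
z ^q suc k = z *q (z ^q k)

ι : ℤi → ℚi
ι (a , b) = (a ℚ./ 1 , b ℚ./ 1)

ofℚ : ℚ → ℚi
ofℚ c = (c , ℚ.0ℚ)

Nq : ℚi → ℚ
Nq (a , b) = a ℚ.* a ℚ.+ b ℚ.* b

eval : Poly → ℚi → ℚi
eval []       t = 0q
eval (c ∷ cs) t = ofℚ c +q t *q eval cs t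

_^ℚ_ : ℚ → ℕ → ℚ
x ^ℚ zero  = ℚ.1ℚ
x ^ℚ suc k = x ℚ.* (x ^ℚ k)

ℕ→ℚ : ℕ → ℚ
ℕ→ℚ k = (+ k) ℚ./ 1

discᵢ : ℤi → ℤi → ℤi
discᵢ A B = ofℤ (+ 4) *ᵢ A ^ᵢ 3 +ᵢ ofℤ (+ 27) *ᵢ B ^ᵢ 2

discq : ℚi → ℚi → ℚi
discq A B = ofℚ (ℕ→ℚ 4) *q A ^q 3 +q ofℚ (ℕ→ℚ 27) *q B ^q 2

-- gcd(A³,B²) not divisible by the 12th power of a non-unit
-- (e divides gcd(A³,B²) iff e divides both A³ and B²).
Twelfth-free : ℤi → ℤi → Set
Twelfth-free A B = ∀ e → (e ^ᵢ 12) ∣ᵢ (A ^ᵢ 3) → (e ^ᵢ 12) ∣ᵢ (B ^ᵢ 2) → IsUnitᵢ e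

-- (A , B) ∈ S(X):  N(A) < X^{1/3} ⇔ N(A)³ < X,  N(B) < X^{1/2} ⇔ N(B)² < X
InS : Poly → Poly → ℚ → ℤi → ℤi → Set
InS f g X A B =
  (discᵢ A B ≢ 0ᵢ) × Twelfth-free A B ×
  (ℕ→ℚ (Nᵢ A) ^ℚ 3 ℚ.< X) × (ℕ→ℚ (Nᵢ B) ^ℚ 2 ℚ.< X) ×
  (∃ λ u → ∃ λ t → (ι A ≡ u ^q 4 *q eval f t) × (ι B ≡ u ^q 6 *q eval g t))

-- Given (a , b) and t with t·b^m = a (i.e. t = a / b^m, b ≠ 0), with u = b^n:
Aof : Poly → ℕ → ℤi → ℚi → ℚi
Aof f n b t = (ι b ^q n) ^q 4 *q eval f t

Bof : Poly → ℕ → ℤi → ℚi → ℚi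
Bof g n b t = (ι b ^q n) ^q 6 *q eval g t

-- (a , b) ∈ S₂(X):  N(a) < κ X^{m/12n} ⇔ N(a)^{12n} < κ^{12n} X^m,
--                   N(b) < κ X^{1/12n} ⇔ N(b)^{12n} < κ^{12n} X.
InS₂ : Poly → Poly → ℕ → ℕ → ℚ → ℚ → ℤi → ℤi → Set
InS₂ f g n m κ X a b =
  CoprimeI a b × (b ≢ 0ᵢ) ×
  (ℕ→ℚ (Nᵢ a) ^ℚ (12 ℕ.* n) ℚ.< (κ ^ℚ (12 ℕ.* n)) ℚ.* (X ^ℚ m)) ×
  (ℕ→ℚ (Nᵢ b) ^ℚ (12 ℕ.* n) ℚ.< (κ ^ℚ (12 ℕ.* n)) ℚ.* X) ×
  (∀ t → t *q (ι b ^q m) ≡ ι a → discq (Aof f n b t) (Bof g n b t) ≢ 0q)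

InS₃ : Poly → Poly → ℕ → ℕ → ℚ → ℚ → ℤi → ℤi → Set
InS₃ f g n m κ X A B =
  ∃ λ a → ∃ λ b → InS₂ f g n m κ X a b ×
    ∃ λ t → (t *q (ι b ^q m) ≡ ι a) × (ι A ≡ Aof f n b t) × (ι B ≡ Bof g n b t)

Largest12 : ℤi → ℤi → ℤi → Set
Largest12 A B d =
  (d ^ᵢ 12) ∣ᵢ (A ^ᵢ 3) × (d ^ᵢ 12) ∣ᵢ (B ^ᵢ 2) ×
  (∀ e → (e ^ᵢ 12) ∣ᵢ (A ^ᵢ 3) → (e ^ᵢ 12) ∣ᵢ (B ^ᵢ 2) → Nᵢ e ℕ.≤ Nᵢ d)

-- the map S₃(X) → S(X), (A , B) ↦ (A / d⁴ , B / d⁶) with d = D A B,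
-- sends (A , B) to (A' , B')  (exact division written multiplicatively)
MapsTo : (ℤi → ℤi → ℤi) → ℤi × ℤi → ℤi × ℤi → Set
MapsTo D (A , B) (A' , B') = (A ≡ (D A B ^ᵢ 4) *ᵢ A') × (B ≡ (D A B ^ᵢ 6) *ᵢ B')

-- Clearing denominators in a Bézout identity
-- u f + v g = 1 of ℚ[t] puts R·bᴱ into the ideal (A, B) of ℤ[i], with R and E depending only on
-- f, g, n and m. One of 4n = m r and 6n = m s holds, say the first; then A is congruent to c·aʳ
-- modulo b, where c is the leading coefficient of f with denominators cleared, and since a and b
-- are coprime, c lies in (A, b). Together, a fixed nonzero T = R⁶·c¹⁸ᴱ lies in every ideal
-- (A³, B²), so d¹² divides T for the d attached to any point of the fibre over (A′, B′). Hence
-- N(d) ≤ N(T), and the point, being (d⁴A′, d⁶B′), is one of finitely many.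

module Submission where

open import Defs
open import Algebra.Bundles using (CommutativeRing; RawRing)
open import Algebra.Morphism.Structures using (IsRingMonomorphism)
import Algebra.Morphism.RingMonomorphism as RingMonomorphism
import Algebra.Properties.CommutativeSemiring.Exp as CommutativeSemiringExp
import Algebra.Properties.Semiring.Exp as SemiringExp
open import Algebra.Structures using (IsCommutativeMonoid; IsCommutativeSemiring)
open import Algebra.Structures.Biased using (module IsCommutativeSemiringˡ)
open import Data.Empty using (⊥-elim)
open import Data.Integer as ℤ using (ℤ; +_; -[1+_])
import Data.Integer.DivMod as ℤ
import Data.Integer.GCD as ℤ
import Data.Integer.Properties as ℤ
open import Data.List using (List; []; _∷_; length; map; _++_; applyUpTo; cartesianProduct)
open import Data.List.Membership.Propositional using (_∈_)
open import Data.List.Membership.Propositional.Properties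
  using (∈-map⁺; ∈-++⁺ˡ; ∈-++⁺ʳ; ∈-applyUpTo⁺; ∈-cartesianProduct⁺)
open import Data.List.Properties using (length-map; length-removeAt′)
open import Data.List.Relation.Unary.All as All using (All)
open import Data.List.Relation.Unary.AllPairs using ([]; _∷_)
open import Data.List.Relation.Unary.Any using (here; there; index; _─_)
open import Data.List.Relation.Unary.Unique.Propositional using (Unique)
open import Data.Maybe using (Maybe; just; nothing)
open import Data.Nat as ℕ using (ℕ; zero; suc; _≤_; _<_; z≤n; s≤s; NonZero)
open import Data.Nat.Coprimality using (Coprime)
import Data.Nat.Properties as ℕ
open import Data.Nat.Tactic.RingSolver using () renaming (solve-∀ to ℕ-solve-∀)
open import Data.Product using (_×_; _,_; ∃; ∃₂; proj₁; proj₂)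
open import Data.Product.Properties using (≡-dec)
open import Data.Rational as ℚ using (ℚ; 0ℚ; 1ℚ)
import Data.Rational.Properties as ℚ
import Data.Rational.Unnormalised as ℚᵘ
import Data.Rational.Unnormalised.Properties as ℚᵘ
open import Data.Sum using (_⊎_; inj₁; inj₂; [_,_]′)
open import Function using (_∘_)
open import Relation.Binary.PropositionalEquality
open import Relation.Nullary using (yes; no)
open import Relation.Nullary.Decidable.Core using (dec⇒maybe)
open import Tactic.RingSolver using (solve-∀)
open import Tactic.RingSolver.Core.AlmostCommutativeRing using (AlmostCommutativeRing; fromCommutativeRing)

ℤ-ring ℚ-ring : AlmostCommutativeRing _ _
ℤ-ring = fromCommutativeRing ℤ.+-*-commutativeRing (λ x → dec⇒maybe (ℤ.0ℤ ℤ.≟ x))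
ℚ-ring = fromCommutativeRing ℚ.+-*-commutativeRing (λ x → dec⇒maybe (ℚ.0ℚ ℚ.≟ x))

ℤ→ℚ : ℤ → ℚ
ℤ→ℚ z = z ℚ./ 1

↥-ℤ→ℚ : ∀ z → ℚ.↥ (ℤ→ℚ z) ≡ z
↥-ℤ→ℚ z = trans (sym (ℤ.*-identityʳ _))
  (trans (cong (ℚ.↥ (ℤ→ℚ z) ℤ.*_) (sym (ℤ.gcd-zeroʳ z))) (ℚ.↥-/ z 1))

↧-ℤ→ℚ : ∀ z → ℚ.↧ (ℤ→ℚ z) ≡ + 1
↧-ℤ→ℚ z = trans (sym (ℤ.*-identityʳ _))
  (trans (cong (ℚ.↧ (ℤ→ℚ z) ℤ.*_) (sym (ℤ.gcd-zeroʳ z))) (ℚ.↧-/ z 1))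

ℤ→ℚ-injective : ∀ {x y} → ℤ→ℚ x ≡ ℤ→ℚ y → x ≡ y
ℤ→ℚ-injective {x} {y} e = trans (sym (↥-ℤ→ℚ x)) (trans (cong ℚ.↥_ e) (↥-ℤ→ℚ y))

toℚᵘ-ℤ→ℚ : ∀ z → ℚ.toℚᵘ (ℤ→ℚ z) ℚᵘ.≃ ℚᵘ.mkℚᵘ z 0
toℚᵘ-ℤ→ℚ z = ℚᵘ.*≡* (cong₂ ℤ._*_ (trans (ℚ.↥ᵘ-toℚᵘ (ℤ→ℚ z)) (↥-ℤ→ℚ z))
                                   (sym (trans (ℚ.↧ᵘ-toℚᵘ (ℤ→ℚ z)) (↧-ℤ→ℚ z))))

ℤ→ℚ-+ : ∀ x y → ℤ→ℚ (x ℤ.+ y) ≡ ℤ→ℚ x ℚ.+ ℤ→ℚ y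
ℤ→ℚ-+ x y = ℚ.toℚᵘ-injective (ℚᵘ.≃-trans (toℚᵘ-ℤ→ℚ (x ℤ.+ y)) (ℚᵘ.≃-sym
  (ℚᵘ.≃-trans (ℚ.toℚᵘ-homo-+ (ℤ→ℚ x) (ℤ→ℚ y))
  (ℚᵘ.≃-trans (ℚᵘ.+-cong (toℚᵘ-ℤ→ℚ x) (toℚᵘ-ℤ→ℚ y)) (ℚᵘ.*≡* (lemma x y))))))
  where
  lemma : ∀ x y → (x ℤ.* + 1 ℤ.+ y ℤ.* + 1) ℤ.* + 1 ≡ (x ℤ.+ y) ℤ.* + 1
  lemma = solve-∀ ℤ-ring

ℤ→ℚ-* : ∀ x y → ℤ→ℚ (x ℤ.* y) ≡ ℤ→ℚ x ℚ.* ℤ→ℚ y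
ℤ→ℚ-* x y = ℚ.toℚᵘ-injective (ℚᵘ.≃-trans (toℚᵘ-ℤ→ℚ (x ℤ.* y)) (ℚᵘ.≃-sym
  (ℚᵘ.≃-trans (ℚ.toℚᵘ-homo-* (ℤ→ℚ x) (ℤ→ℚ y)) (ℚᵘ.*-cong (toℚᵘ-ℤ→ℚ x) (toℚᵘ-ℤ→ℚ y)))))

ℤ→ℚ-neg : ∀ x → ℤ→ℚ (ℤ.- x) ≡ ℚ.- ℤ→ℚ x
ℤ→ℚ-neg x = ℚ.toℚᵘ-injective (ℚᵘ.≃-trans (toℚᵘ-ℤ→ℚ (ℤ.- x)) (ℚᵘ.≃-sym
  (ℚᵘ.≃-trans (ℚ.toℚᵘ-homo‿- (ℤ→ℚ x)) (ℚᵘ.-‿cong (toℚᵘ-ℤ→ℚ x)))))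

-q_ : ℚi → ℚi
-q (a , b) = (ℚ.- a , ℚ.- b)

ℚ[i]-commutativeRing : CommutativeRing _ _
ℚ[i]-commutativeRing = record
  { Carrier = ℚi ; _≈_ = _≡_ ; _+_ = _+q_ ; _*_ = _*q_ ; -_ = -q_ ; 0# = 0q ; 1# = 1q
  ; isCommutativeRing = record
    { isRing = record
      { +-isAbelianGroup = record
        { isGroup = record
          { isMonoid = record
            { isSemigroup = record
              { isMagma = record { isEquivalence = isEquivalence ; ∙-cong = cong₂ _+q_ }
              ; assoc = λ (a , b) (c , d) (e , f) → pair (ℚ.+-assoc a c e) (ℚ.+-assoc b d f) }
            ; identity = (λ (a , b) → pair (ℚ.+-identityˡ a) (ℚ.+-identityˡ b))
                       , (λ (a , b) → pair (ℚ.+-identityʳ a) (ℚ.+-identityʳ b)) }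
          ; inverse = (λ (a , b) → pair (ℚ.+-inverseˡ a) (ℚ.+-inverseˡ b))
                    , (λ (a , b) → pair (ℚ.+-inverseʳ a) (ℚ.+-inverseʳ b))
          ; ⁻¹-cong = cong -q_ }
        ; comm = λ (a , b) (c , d) → pair (ℚ.+-comm a c) (ℚ.+-comm b d) }
      ; *-cong = cong₂ _*q_
      ; *-assoc = λ (a , b) (c , d) (e , f) → pair (assoc₁ a b c d e f) (assoc₂ a b c d e f)
      ; *-identity = (λ (a , b) → pair (identityˡ₁ a b) (identityˡ₂ a b))
                   , (λ (a , b) → pair (identityʳ₁ a b) (identityʳ₂ a b))
      ; distrib = (λ (a , b) (c , d) (e , f) → pair (distribˡ₁ a b c d e f) (distribˡ₂ a b c d e f))
                , (λ (a , b) (c , d) (e , f) → pair (distribʳ₁ a b c d e f) (distribʳ₂ a b c d e f)) }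
    ; *-comm = λ (a , b) (c , d) → pair (comm₁ a b c d) (comm₂ a b c d) } }
  where
  open import Data.Rational.Base using (_+_; _*_; _-_; -_; 0ℚ; 1ℚ)
  pair : ∀ {a b c d : ℚ} → a ≡ c → b ≡ d → (a , b) ≡ (c , d)
  pair = cong₂ _,_
  assoc₁ : ∀ a b c d e f → (a * c - b * d) * e - (a * d + b * c) * f ≡ a * (c * e - d * f) - b * (c * f + d * e)
  assoc₁ = solve-∀ ℚ-ring
  assoc₂ : ∀ a b c d e f → (a * c - b * d) * f + (a * d + b * c) * e ≡ a * (c * f + d * e) + b * (c * e - d * f)
  assoc₂ = solve-∀ ℚ-ring
  identityˡ₁ : ∀ a b → 1ℚ * a - 0ℚ * b ≡ a
  identityˡ₁ = solve-∀ ℚ-ring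
  identityˡ₂ : ∀ a b → 1ℚ * b + 0ℚ * a ≡ b
  identityˡ₂ = solve-∀ ℚ-ring
  identityʳ₁ : ∀ a b → a * 1ℚ - b * 0ℚ ≡ a
  identityʳ₁ = solve-∀ ℚ-ring
  identityʳ₂ : ∀ a b → a * 0ℚ + b * 1ℚ ≡ b
  identityʳ₂ = solve-∀ ℚ-ring
  distribˡ₁ : ∀ a b c d e f → a * (c + e) - b * (d + f) ≡ (a * c - b * d) + (a * e - b * f)
  distribˡ₁ = solve-∀ ℚ-ring
  distribˡ₂ : ∀ a b c d e f → a * (d + f) + b * (c + e) ≡ (a * d + b * c) + (a * f + b * e)
  distribˡ₂ = solve-∀ ℚ-ring
  distribʳ₁ : ∀ a b c d e f → (c + e) * a - (d + f) * b ≡ (c * a - d * b) + (e * a - f * b)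
  distribʳ₁ = solve-∀ ℚ-ring
  distribʳ₂ : ∀ a b c d e f → (c + e) * b + (d + f) * a ≡ (c * b + d * a) + (e * b + f * a)
  distribʳ₂ = solve-∀ ℚ-ring
  comm₁ : ∀ a b c d → a * c - b * d ≡ c * a - d * b
  comm₁ = solve-∀ ℚ-ring
  comm₂ : ∀ a b c d → a * d + b * c ≡ c * b + d * a
  comm₂ = solve-∀ ℚ-ring

ℚ[i]-ring : AlmostCommutativeRing _ _
ℚ[i]-ring = fromCommutativeRing ℚ[i]-commutativeRing
  (λ x → dec⇒maybe (≡-dec ℚ._≟_ ℚ._≟_ 0q x))

open CommutativeRing ℚ[i]-commutativeRing using ()
  renaming (+-identityˡ to +q-identityˡ; +-identityʳ to +q-identityʳ; *-identityʳ to *q-identityʳ;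
            *-assoc to *q-assoc; zeroˡ to *q-zeroˡ; zeroʳ to *q-zeroʳ)

-- ℤ[i] is a subring of ℚ[i]: its ring laws are pulled back along ι.

-ᵢ_ : ℤi → ℤi
-ᵢ (a , b) = (ℤ.- a , ℤ.- b)

ℤ[i]-rawRing : RawRing _ _
ℤ[i]-rawRing = record
  { Carrier = ℤi ; _≈_ = _≡_ ; _+_ = _+ᵢ_ ; _*_ = _*ᵢ_ ; -_ = -ᵢ_ ; 0# = 0ᵢ ; 1# = 1ᵢ }

ι-+ : ∀ w z → ι (w +ᵢ z) ≡ ι w +q ι z
ι-+ (a , b) (c , d) = cong₂ _,_ (ℤ→ℚ-+ a c) (ℤ→ℚ-+ b d)

ι-* : ∀ w z → ι (w *ᵢ z) ≡ ι w *q ι z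
ι-* (a , b) (c , d) = cong₂ _,_
  (trans (ℤ→ℚ-+ (a ℤ.* c) (ℤ.- (b ℤ.* d)))
         (cong₂ ℚ._+_ (ℤ→ℚ-* a c) (trans (ℤ→ℚ-neg (b ℤ.* d)) (cong ℚ.-_ (ℤ→ℚ-* b d)))))
  (trans (ℤ→ℚ-+ (a ℤ.* d) (b ℤ.* c)) (cong₂ ℚ._+_ (ℤ→ℚ-* a d) (ℤ→ℚ-* b c)))

ι-neg : ∀ w → ι (-ᵢ w) ≡ -q ι w
ι-neg (a , b) = cong₂ _,_ (ℤ→ℚ-neg a) (ℤ→ℚ-neg b)

ι-injective : ∀ {w z} → ι w ≡ ι z → w ≡ z
ι-injective e = cong₂ _,_ (ℤ→ℚ-injective (cong proj₁ e)) (ℤ→ℚ-injective (cong proj₂ e))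

ι-isRingMonomorphism : IsRingMonomorphism ℤ[i]-rawRing (CommutativeRing.rawRing ℚ[i]-commutativeRing) ι
ι-isRingMonomorphism = record
  { isRingHomomorphism = record
    { isSemiringHomomorphism = record
      { isNearSemiringHomomorphism = record
        { +-isMonoidHomomorphism = record
          { isMagmaHomomorphism = record
            { isRelHomomorphism = record { cong = cong ι }
            ; homo = ι-+ }
          ; ε-homo = refl }
        ; *-homo = ι-* }
      ; 1#-homo = refl }
    ; -‿homo = ι-neg }
  ; injective = ι-injective }

ℤ[i]-commutativeRing : CommutativeRing _ _
ℤ[i]-commutativeRing = record
  { isCommutativeRing = RingMonomorphism.isCommutativeRing ι-isRingMonomorphism
      (CommutativeRing.isCommutativeRing ℚ[i]-commutativeRing) }

ℤ[i]-ring : AlmostCommutativeRing _ _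
ℤ[i]-ring = fromCommutativeRing ℤ[i]-commutativeRing
  (λ x → dec⇒maybe (≡-dec ℤ._≟_ ℤ._≟_ 0ᵢ x))

open CommutativeRing ℤ[i]-commutativeRing using ()
  renaming (*-identityˡ to *ᵢ-identityˡ; *-identityʳ to *ᵢ-identityʳ; zeroˡ to *ᵢ-zeroˡ)

module ℚ[i]-Exp = SemiringExp (CommutativeRing.semiring ℚ[i]-commutativeRing)
module ℤ[i]-Exp = SemiringExp (CommutativeRing.semiring ℤ[i]-commutativeRing)

^q≡^ : ∀ x n → x ^q n ≡ x ℚ[i]-Exp.^ n
^q≡^ x zero    = refl
^q≡^ x (suc n) = cong (x *q_) (^q≡^ x n)

^ᵢ≡^ : ∀ x n → x ^ᵢ n ≡ x ℤ[i]-Exp.^ n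
^ᵢ≡^ x zero    = refl
^ᵢ≡^ x (suc n) = cong (x *ᵢ_) (^ᵢ≡^ x n)

^q-homo-* : ∀ x m n → x ^q (m ℕ.+ n) ≡ x ^q m *q x ^q n
^q-homo-* x m n rewrite ^q≡^ x (m ℕ.+ n) | ^q≡^ x m | ^q≡^ x n = ℚ[i]-Exp.^-homo-* x m n

^q-assocʳ : ∀ x m n → (x ^q m) ^q n ≡ x ^q (m ℕ.* n)
^q-assocʳ x m n rewrite ^q≡^ (x ^q m) n | ^q≡^ x m | ^q≡^ x (m ℕ.* n) = ℚ[i]-Exp.^-assocʳ x m n

^ᵢ-assocʳ : ∀ x m n → (x ^ᵢ m) ^ᵢ n ≡ x ^ᵢ (m ℕ.* n)
^ᵢ-assocʳ x m n rewrite ^ᵢ≡^ (x ^ᵢ m) n | ^ᵢ≡^ x m | ^ᵢ≡^ x (m ℕ.* n) = ℤ[i]-Exp.^-assocʳ x m n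

^ᵢ-distrib-* : ∀ x y n → (x *ᵢ y) ^ᵢ n ≡ x ^ᵢ n *ᵢ y ^ᵢ n
^ᵢ-distrib-* x y n rewrite ^ᵢ≡^ (x *ᵢ y) n | ^ᵢ≡^ x n | ^ᵢ≡^ y n =
  CommutativeSemiringExp.^-distrib-* (CommutativeRing.commutativeSemiring ℤ[i]-commutativeRing) x y n

ι-^ : ∀ w k → ι (w ^ᵢ k) ≡ ι w ^q k
ι-^ w zero    = refl
ι-^ w (suc k) = trans (ι-* w (w ^ᵢ k)) (cong (ι w *q_) (ι-^ w k))

-- Two-generator ideals of ℤ[i]

Integral : ℚi → Set
Integral z = ∃ λ w → ι w ≡ z

Integral-ι : ∀ w → Integral (ι w)
Integral-ι w = w , refl

Integral-+ : ∀ {x y} → Integral x → Integral y → Integral (x +q y)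
Integral-+ (w , refl) (z , refl) = w +ᵢ z , ι-+ w z

Integral-* : ∀ {x y} → Integral x → Integral y → Integral (x *q y)
Integral-* (w , refl) (z , refl) = w *ᵢ z , ι-* w z

Integral-^ : ∀ {x} k → Integral x → Integral (x ^q k)
Integral-^ k (w , refl) = w ^ᵢ k , ι-^ w k

Integral-neg : ∀ {x} → Integral x → Integral (-q x)
Integral-neg (w , refl) = -ᵢ w , ι-neg w

infix 4 _∈⟨_,_⟩

_∈⟨_,_⟩ : ℤi → ℤi → ℤi → Set
z ∈⟨ x , y ⟩ = ∃₂ λ p q → z ≡ p *ᵢ x +ᵢ q *ᵢ y

∈⟨⟩-comm : ∀ {z x y} → z ∈⟨ x , y ⟩ → z ∈⟨ y , x ⟩
∈⟨⟩-comm {x = x} {y} (p , q , e) = q , p , trans e (comm p x q y)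
  where
  comm : ∀ p x q y → p *ᵢ x +ᵢ q *ᵢ y ≡ q *ᵢ y +ᵢ p *ᵢ x
  comm = solve-∀ ℤ[i]-ring

binomial-congruence : ∀ x y k → ∃ λ c → (x +ᵢ y) ^ᵢ k ≡ x *ᵢ c +ᵢ y ^ᵢ k
binomial-congruence x y zero = 0ᵢ , base x
  where
  base : ∀ x → 1ᵢ ≡ x *ᵢ 0ᵢ +ᵢ 1ᵢ
  base = solve-∀ ℤ[i]-ring
binomial-congruence x y (suc k) with binomial-congruence x y k
... | c , e = c *ᵢ (x +ᵢ y) +ᵢ y ^ᵢ k , trans (cong ((x +ᵢ y) *ᵢ_) e) (step x y c (y ^ᵢ k))
  where
  step : ∀ x y c w → (x +ᵢ y) *ᵢ (x *ᵢ c +ᵢ w) ≡ x *ᵢ (c *ᵢ (x +ᵢ y) +ᵢ w) +ᵢ y *ᵢ w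
  step = solve-∀ ℤ[i]-ring

∈⟨⟩-^ : ∀ {z x y} k → z ∈⟨ x , y ⟩ → z ^ᵢ k ∈⟨ x , y ^ᵢ k ⟩
∈⟨⟩-^ {z} {x} {y} k (p , q , e) with binomial-congruence (p *ᵢ x) (q *ᵢ y) k
... | c , e′ = p *ᵢ c , q ^ᵢ k , (begin
  z ^ᵢ k                          ≡⟨ cong (_^ᵢ k) e ⟩
  (p *ᵢ x +ᵢ q *ᵢ y) ^ᵢ k         ≡⟨ e′ ⟩
  p *ᵢ x *ᵢ c +ᵢ (q *ᵢ y) ^ᵢ k    ≡⟨ cong (p *ᵢ x *ᵢ c +ᵢ_) (^ᵢ-distrib-* q y k) ⟩
  p *ᵢ x *ᵢ c +ᵢ q ^ᵢ k *ᵢ y ^ᵢ k ≡⟨ cong (_+ᵢ q ^ᵢ k *ᵢ y ^ᵢ k) (swap p x c) ⟩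
  p *ᵢ c *ᵢ x +ᵢ q ^ᵢ k *ᵢ y ^ᵢ k ∎)
  where
  open ≡-Reasoning
  swap : ∀ p x c → p *ᵢ x *ᵢ c ≡ p *ᵢ c *ᵢ x
  swap = solve-∀ ℤ[i]-ring

∈⟨⟩-replace : ∀ {z x y w} c → z ∈⟨ x , w ⟩ → c *ᵢ w ∈⟨ x , y ⟩ → c *ᵢ z ∈⟨ x , y ⟩
∈⟨⟩-replace {z} {x} {y} {w} c (p , q , e) (p′ , q′ , e′) =
  c *ᵢ p +ᵢ q *ᵢ p′ , q *ᵢ q′ , (begin
  c *ᵢ z                                ≡⟨ cong (c *ᵢ_) e ⟩
  c *ᵢ (p *ᵢ x +ᵢ q *ᵢ w)               ≡⟨ expand c p x q w ⟩
  c *ᵢ p *ᵢ x +ᵢ q *ᵢ (c *ᵢ w)          ≡⟨ cong (λ v → c *ᵢ p *ᵢ x +ᵢ q *ᵢ v) e′ ⟩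
  c *ᵢ p *ᵢ x +ᵢ q *ᵢ (p′ *ᵢ x +ᵢ q′ *ᵢ y) ≡⟨ collect c p x q p′ q′ y ⟩
  (c *ᵢ p +ᵢ q *ᵢ p′) *ᵢ x +ᵢ q *ᵢ q′ *ᵢ y ∎)
  where
  open ≡-Reasoning
  expand : ∀ c p x q w → c *ᵢ (p *ᵢ x +ᵢ q *ᵢ w) ≡ c *ᵢ p *ᵢ x +ᵢ q *ᵢ (c *ᵢ w)
  expand = solve-∀ ℤ[i]-ring
  collect : ∀ c p x q p′ q′ y → c *ᵢ p *ᵢ x +ᵢ q *ᵢ (p′ *ᵢ x +ᵢ q′ *ᵢ y) ≡ (c *ᵢ p +ᵢ q *ᵢ p′) *ᵢ x +ᵢ q *ᵢ q′ *ᵢ y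
  collect = solve-∀ ℤ[i]-ring

∈⟨⟩-ι : ∀ {z x y p q} → Integral p → Integral q → ι z ≡ p *q ι x +q q *q ι y → z ∈⟨ x , y ⟩
∈⟨⟩-ι {z} {x} {y} (p , refl) (q , refl) e = p , q , ι-injective (begin
  ι z                           ≡⟨ e ⟩
  ι p *q ι x +q ι q *q ι y      ≡⟨ cong₂ _+q_ (ι-* p x) (ι-* q y) ⟨
  ι (p *ᵢ x) +q ι (q *ᵢ y)      ≡⟨ ι-+ (p *ᵢ x) (q *ᵢ y) ⟨
  ι (p *ᵢ x +ᵢ q *ᵢ y)          ∎)
  where open ≡-Reasoning

-- The polynomial ring ℚ[t]

-- Coefficient lists with trailing zeros represent the same polynomial, so the ring laws
-- hold only up to _≈ₚ_.

infix 4 _≈ₚ_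

record _≈ₚ_ (p q : Poly) : Set where
  constructor coeffwise
  field coeff-≡ : ∀ k → coeff p k ≡ coeff q k
open _≈ₚ_

1ₚ : Poly
1ₚ = 1ℚ ∷ []

-ₚ_ : Poly → Poly
-ₚ_ = scaleₚ (ℚ.- 1ℚ)

coeff-+ₚ : ∀ p q k → coeff (p +ₚ q) k ≡ coeff p k ℚ.+ coeff q k
coeff-+ₚ []      q       k       = sym (ℚ.+-identityˡ _)
coeff-+ₚ (a ∷ p) []      k       = sym (ℚ.+-identityʳ _)
coeff-+ₚ (a ∷ p) (b ∷ q) zero    = refl
coeff-+ₚ (a ∷ p) (b ∷ q) (suc k) = coeff-+ₚ p q k

coeff-scaleₚ : ∀ c p k → coeff (scaleₚ c p) k ≡ c ℚ.* coeff p k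
coeff-scaleₚ c []      k       = sym (ℚ.*-zeroʳ c)
coeff-scaleₚ c (a ∷ p) zero    = refl
coeff-scaleₚ c (a ∷ p) (suc k) = coeff-scaleₚ c p k

coeff-*ₚ-zero : ∀ a p q → coeff ((a ∷ p) *ₚ q) 0 ≡ a ℚ.* coeff q 0
coeff-*ₚ-zero a p q = trans (coeff-+ₚ (scaleₚ a q) (0ℚ ∷ p *ₚ q) 0)
  (trans (ℚ.+-identityʳ _) (coeff-scaleₚ a q 0))

coeff-*ₚ-suc : ∀ a p q k → coeff ((a ∷ p) *ₚ q) (suc k) ≡ a ℚ.* coeff q (suc k) ℚ.+ coeff (p *ₚ q) k
coeff-*ₚ-suc a p q k = trans (coeff-+ₚ (scaleₚ a q) (0ℚ ∷ p *ₚ q) (suc k))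
  (cong (ℚ._+ coeff (p *ₚ q) k) (coeff-scaleₚ a q (suc k)))

≈ₚ-refl : ∀ {p} → p ≈ₚ p
≈ₚ-refl = coeffwise λ _ → refl

≈ₚ-sym : ∀ {p q} → p ≈ₚ q → q ≈ₚ p
≈ₚ-sym e = coeffwise λ k → sym (coeff-≡ e k)

≈ₚ-trans : ∀ {p q r} → p ≈ₚ q → q ≈ₚ r → p ≈ₚ r
≈ₚ-trans e f = coeffwise λ k → trans (coeff-≡ e k) (coeff-≡ f k)

∷-cong : ∀ {a b p q} → a ≡ b → p ≈ₚ q → (a ∷ p) ≈ₚ (b ∷ q)
∷-cong a≡b e = coeffwise λ { zero → a≡b ; (suc k) → coeff-≡ e k }

+ₚ-cong : ∀ {p p′ q q′} → p ≈ₚ p′ → q ≈ₚ q′ → p +ₚ q ≈ₚ p′ +ₚ q′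
+ₚ-cong {p} {p′} {q} {q′} e f = coeffwise λ k → trans (coeff-+ₚ p q k)
  (trans (cong₂ ℚ._+_ (coeff-≡ e k) (coeff-≡ f k)) (sym (coeff-+ₚ p′ q′ k)))

scaleₚ-cong : ∀ c {p p′} → p ≈ₚ p′ → scaleₚ c p ≈ₚ scaleₚ c p′
scaleₚ-cong c {p} {p′} e = coeffwise λ k → trans (coeff-scaleₚ c p k)
  (trans (cong (c ℚ.*_) (coeff-≡ e k)) (sym (coeff-scaleₚ c p′ k)))

*ₚ-congʳ : ∀ p {q q′} → q ≈ₚ q′ → p *ₚ q ≈ₚ p *ₚ q′
*ₚ-congʳ []      e = ≈ₚ-refl
*ₚ-congʳ (a ∷ p) e = +ₚ-cong (scaleₚ-cong a e) (∷-cong refl (*ₚ-congʳ p e))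

+ₚ-assoc : ∀ p q r → (p +ₚ q) +ₚ r ≈ₚ p +ₚ (q +ₚ r)
+ₚ-assoc p q r = coeffwise λ k → begin
  coeff ((p +ₚ q) +ₚ r) k                  ≡⟨ coeff-+ₚ (p +ₚ q) r k ⟩
  coeff (p +ₚ q) k ℚ.+ coeff r k           ≡⟨ cong (ℚ._+ coeff r k) (coeff-+ₚ p q k) ⟩
  coeff p k ℚ.+ coeff q k ℚ.+ coeff r k    ≡⟨ ℚ.+-assoc (coeff p k) (coeff q k) (coeff r k) ⟩
  coeff p k ℚ.+ (coeff q k ℚ.+ coeff r k)  ≡⟨ cong (coeff p k ℚ.+_) (coeff-+ₚ q r k) ⟨
  coeff p k ℚ.+ coeff (q +ₚ r) k           ≡⟨ coeff-+ₚ p (q +ₚ r) k ⟨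
  coeff (p +ₚ (q +ₚ r)) k                  ∎
  where open ≡-Reasoning

+ₚ-comm : ∀ p q → p +ₚ q ≈ₚ q +ₚ p
+ₚ-comm p q = coeffwise λ k →
  trans (coeff-+ₚ p q k) (trans (ℚ.+-comm (coeff p k) (coeff q k)) (sym (coeff-+ₚ q p k)))

+ₚ-identityʳ : ∀ p → p +ₚ [] ≈ₚ p
+ₚ-identityʳ p = coeffwise λ k → trans (coeff-+ₚ p [] k) (ℚ.+-identityʳ _)

scaleₚ-*ₚ : ∀ c p q → scaleₚ c p *ₚ q ≈ₚ scaleₚ c (p *ₚ q)
scaleₚ-*ₚ c [] q = ≈ₚ-refl
scaleₚ-*ₚ c (a ∷ p) q = coeffwise λ
  { zero → begin
      coeff ((c ℚ.* a ∷ scaleₚ c p) *ₚ q) 0  ≡⟨ coeff-*ₚ-zero (c ℚ.* a) (scaleₚ c p) q ⟩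
      c ℚ.* a ℚ.* coeff q 0                  ≡⟨ ℚ.*-assoc c a (coeff q 0) ⟩
      c ℚ.* (a ℚ.* coeff q 0)                ≡⟨ cong (c ℚ.*_) (coeff-*ₚ-zero a p q) ⟨
      c ℚ.* coeff ((a ∷ p) *ₚ q) 0           ≡⟨ coeff-scaleₚ c ((a ∷ p) *ₚ q) 0 ⟨
      coeff (scaleₚ c ((a ∷ p) *ₚ q)) 0      ∎
  ; (suc k) → begin
      coeff ((c ℚ.* a ∷ scaleₚ c p) *ₚ q) (suc k)
        ≡⟨ coeff-*ₚ-suc (c ℚ.* a) (scaleₚ c p) q k ⟩
      c ℚ.* a ℚ.* coeff q (suc k) ℚ.+ coeff (scaleₚ c p *ₚ q) k
        ≡⟨ cong₂ ℚ._+_ (ℚ.*-assoc c a _) (trans (coeff-≡ (scaleₚ-*ₚ c p q) k) (coeff-scaleₚ c (p *ₚ q) k)) ⟩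
      c ℚ.* (a ℚ.* coeff q (suc k)) ℚ.+ c ℚ.* coeff (p *ₚ q) k
        ≡⟨ ℚ.*-distribˡ-+ c _ _ ⟨
      c ℚ.* (a ℚ.* coeff q (suc k) ℚ.+ coeff (p *ₚ q) k)
        ≡⟨ cong (c ℚ.*_) (coeff-*ₚ-suc a p q k) ⟨
      c ℚ.* coeff ((a ∷ p) *ₚ q) (suc k)
        ≡⟨ coeff-scaleₚ c ((a ∷ p) *ₚ q) (suc k) ⟨
      coeff (scaleₚ c ((a ∷ p) *ₚ q)) (suc k) ∎ }
  where open ≡-Reasoning

*ₚ-distribʳ-+ₚ : ∀ q p p′ → (p +ₚ p′) *ₚ q ≈ₚ (p *ₚ q) +ₚ (p′ *ₚ q)
*ₚ-distribʳ-+ₚ q []      p′ = ≈ₚ-refl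
*ₚ-distribʳ-+ₚ q (a ∷ p) [] = ≈ₚ-sym (+ₚ-identityʳ ((a ∷ p) *ₚ q))
*ₚ-distribʳ-+ₚ q (a ∷ p) (b ∷ p′) = coeffwise λ
  { zero → begin
      coeff ((a ℚ.+ b ∷ p +ₚ p′) *ₚ q) 0                  ≡⟨ coeff-*ₚ-zero (a ℚ.+ b) (p +ₚ p′) q ⟩
      (a ℚ.+ b) ℚ.* coeff q 0                             ≡⟨ ℚ.*-distribʳ-+ _ a b ⟩
      a ℚ.* coeff q 0 ℚ.+ b ℚ.* coeff q 0                 ≡⟨ cong₂ ℚ._+_ (coeff-*ₚ-zero a p q) (coeff-*ₚ-zero b p′ q) ⟨
      coeff ((a ∷ p) *ₚ q) 0 ℚ.+ coeff ((b ∷ p′) *ₚ q) 0  ≡⟨ coeff-+ₚ ((a ∷ p) *ₚ q) ((b ∷ p′) *ₚ q) 0 ⟨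
      coeff (((a ∷ p) *ₚ q) +ₚ ((b ∷ p′) *ₚ q)) 0             ∎
  ; (suc k) → begin
      coeff ((a ℚ.+ b ∷ p +ₚ p′) *ₚ q) (suc k)
        ≡⟨ coeff-*ₚ-suc (a ℚ.+ b) (p +ₚ p′) q k ⟩
      (a ℚ.+ b) ℚ.* coeff q (suc k) ℚ.+ coeff ((p +ₚ p′) *ₚ q) k
        ≡⟨ cong₂ ℚ._+_ (ℚ.*-distribʳ-+ _ a b) (trans (coeff-≡ (*ₚ-distribʳ-+ₚ q p p′) k) (coeff-+ₚ (p *ₚ q) (p′ *ₚ q) k)) ⟩
      (a ℚ.* coeff q (suc k) ℚ.+ b ℚ.* coeff q (suc k)) ℚ.+ (coeff (p *ₚ q) k ℚ.+ coeff (p′ *ₚ q) k)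
        ≡⟨ interchange (a ℚ.* coeff q (suc k)) (b ℚ.* coeff q (suc k)) (coeff (p *ₚ q) k) (coeff (p′ *ₚ q) k) ⟩
      (a ℚ.* coeff q (suc k) ℚ.+ coeff (p *ₚ q) k) ℚ.+ (b ℚ.* coeff q (suc k) ℚ.+ coeff (p′ *ₚ q) k)
        ≡⟨ cong₂ ℚ._+_ (coeff-*ₚ-suc a p q k) (coeff-*ₚ-suc b p′ q k) ⟨
      coeff ((a ∷ p) *ₚ q) (suc k) ℚ.+ coeff ((b ∷ p′) *ₚ q) (suc k)
        ≡⟨ coeff-+ₚ ((a ∷ p) *ₚ q) ((b ∷ p′) *ₚ q) (suc k) ⟨
      coeff (((a ∷ p) *ₚ q) +ₚ ((b ∷ p′) *ₚ q)) (suc k) ∎ }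
  where
  open ≡-Reasoning
  interchange : ∀ x y z w → (x ℚ.+ y) ℚ.+ (z ℚ.+ w) ≡ (x ℚ.+ z) ℚ.+ (y ℚ.+ w)
  interchange = solve-∀ ℚ-ring

0∷-*ₚ : ∀ p q → (0ℚ ∷ p) *ₚ q ≈ₚ 0ℚ ∷ p *ₚ q
0∷-*ₚ p q = coeffwise λ
  { zero → trans (coeff-*ₚ-zero 0ℚ p q) (ℚ.*-zeroˡ (coeff q 0))
  ; (suc k) → trans (coeff-*ₚ-suc 0ℚ p q k)
      (trans (cong (ℚ._+ coeff (p *ₚ q) k) (ℚ.*-zeroˡ (coeff q (suc k)))) (ℚ.+-identityˡ _)) }

*ₚ-assoc : ∀ p q r → (p *ₚ q) *ₚ r ≈ₚ p *ₚ (q *ₚ r)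
*ₚ-assoc []      q r = ≈ₚ-refl
*ₚ-assoc (a ∷ p) q r = ≈ₚ-trans (*ₚ-distribʳ-+ₚ r (scaleₚ a q) (0ℚ ∷ p *ₚ q))
  (+ₚ-cong (scaleₚ-*ₚ a q r) (≈ₚ-trans (0∷-*ₚ (p *ₚ q) r) (∷-cong refl (*ₚ-assoc p q r))))

*ₚ-zeroʳ : ∀ p → p *ₚ [] ≈ₚ []
*ₚ-zeroʳ []      = ≈ₚ-refl
*ₚ-zeroʳ (a ∷ p) = coeffwise λ
  { zero → trans (coeff-*ₚ-zero a p []) (ℚ.*-zeroʳ a)
  ; (suc k) → trans (coeff-*ₚ-suc a p [] k)
      (trans (cong₂ ℚ._+_ (ℚ.*-zeroʳ a) (coeff-≡ (*ₚ-zeroʳ p) k)) (ℚ.+-identityʳ _)) }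

*ₚ-∷ʳ : ∀ q a p → q *ₚ (a ∷ p) ≈ₚ scaleₚ a q +ₚ (0ℚ ∷ q *ₚ p)
*ₚ-∷ʳ [] a p = coeffwise λ { zero → refl ; (suc k) → refl }
*ₚ-∷ʳ (b ∷ q) a p = coeffwise λ
  { zero → trans (coeff-*ₚ-zero b q (a ∷ p))
      (trans (ℚ.*-comm b a) (sym (trans (coeff-+ₚ (scaleₚ a (b ∷ q)) (0ℚ ∷ (b ∷ q) *ₚ p) 0) (ℚ.+-identityʳ _))))
  ; (suc k) → begin
      coeff ((b ∷ q) *ₚ (a ∷ p)) (suc k)
        ≡⟨ coeff-*ₚ-suc b q (a ∷ p) k ⟩
      b ℚ.* coeff p k ℚ.+ coeff (q *ₚ (a ∷ p)) k
        ≡⟨ cong (b ℚ.* coeff p k ℚ.+_) (trans (coeff-≡ (*ₚ-∷ʳ q a p) k) (coeff-+ₚ (scaleₚ a q) (0ℚ ∷ q *ₚ p) k)) ⟩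
      b ℚ.* coeff p k ℚ.+ (coeff (scaleₚ a q) k ℚ.+ coeff (0ℚ ∷ q *ₚ p) k)
        ≡⟨ left-comm (b ℚ.* coeff p k) (coeff (scaleₚ a q) k) (coeff (0ℚ ∷ q *ₚ p) k) ⟩
      coeff (scaleₚ a q) k ℚ.+ (b ℚ.* coeff p k ℚ.+ coeff (0ℚ ∷ q *ₚ p) k)
        ≡⟨ cong (coeff (scaleₚ a q) k ℚ.+_) (head-term k) ⟩
      coeff (scaleₚ a q) k ℚ.+ coeff ((b ∷ q) *ₚ p) k
        ≡⟨ coeff-+ₚ (scaleₚ a (b ∷ q)) (0ℚ ∷ (b ∷ q) *ₚ p) (suc k) ⟨
      coeff (scaleₚ a (b ∷ q) +ₚ (0ℚ ∷ (b ∷ q) *ₚ p)) (suc k) ∎ }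
  where
  open ≡-Reasoning
  left-comm : ∀ x y z → x ℚ.+ (y ℚ.+ z) ≡ y ℚ.+ (x ℚ.+ z)
  left-comm = solve-∀ ℚ-ring
  head-term : ∀ k → b ℚ.* coeff p k ℚ.+ coeff (0ℚ ∷ q *ₚ p) k ≡ coeff ((b ∷ q) *ₚ p) k
  head-term zero    = trans (ℚ.+-identityʳ _) (sym (coeff-*ₚ-zero b q p))
  head-term (suc k) = sym (coeff-*ₚ-suc b q p k)

*ₚ-comm : ∀ p q → p *ₚ q ≈ₚ q *ₚ p
*ₚ-comm []      q = ≈ₚ-sym (*ₚ-zeroʳ q)
*ₚ-comm (a ∷ p) q = ≈ₚ-trans (+ₚ-cong (≈ₚ-refl {scaleₚ a q}) (∷-cong refl (*ₚ-comm p q))) (≈ₚ-sym (*ₚ-∷ʳ q a p))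

*ₚ-cong : ∀ {p p′ q q′} → p ≈ₚ p′ → q ≈ₚ q′ → p *ₚ q ≈ₚ p′ *ₚ q′
*ₚ-cong {p} {p′} {q} {q′} e f =
  ≈ₚ-trans (*ₚ-comm p q) (≈ₚ-trans (*ₚ-congʳ q e) (≈ₚ-trans (*ₚ-comm q p′) (*ₚ-congʳ p′ f)))

const-*ₚ : ∀ c q → (c ∷ []) *ₚ q ≈ₚ scaleₚ c q
const-*ₚ c q = coeffwise λ k → trans (coeff-+ₚ (scaleₚ c q) (0ℚ ∷ []) k)
  (trans (cong (coeff (scaleₚ c q) k ℚ.+_) (coeff-0∷[] k)) (ℚ.+-identityʳ _))
  where
  coeff-0∷[] : ∀ k → coeff (0ℚ ∷ []) k ≡ 0ℚ
  coeff-0∷[] zero    = refl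
  coeff-0∷[] (suc k) = refl

*ₚ-identityˡ : ∀ p → 1ₚ *ₚ p ≈ₚ p
*ₚ-identityˡ p = ≈ₚ-trans (const-*ₚ 1ℚ p)
  (coeffwise λ k → trans (coeff-scaleₚ 1ℚ p k) (ℚ.*-identityˡ _))

scaleₚ-+ₚ : ∀ c p q → scaleₚ c p +ₚ scaleₚ c q ≈ₚ scaleₚ c (p +ₚ q)
scaleₚ-+ₚ c p q = coeffwise λ k → begin
  coeff (scaleₚ c p +ₚ scaleₚ c q) k             ≡⟨ coeff-+ₚ (scaleₚ c p) (scaleₚ c q) k ⟩
  coeff (scaleₚ c p) k ℚ.+ coeff (scaleₚ c q) k  ≡⟨ cong₂ ℚ._+_ (coeff-scaleₚ c p k) (coeff-scaleₚ c q k) ⟩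
  c ℚ.* coeff p k ℚ.+ c ℚ.* coeff q k            ≡⟨ ℚ.*-distribˡ-+ c _ _ ⟨
  c ℚ.* (coeff p k ℚ.+ coeff q k)                ≡⟨ cong (c ℚ.*_) (coeff-+ₚ p q k) ⟨
  c ℚ.* coeff (p +ₚ q) k                         ≡⟨ coeff-scaleₚ c (p +ₚ q) k ⟨
  coeff (scaleₚ c (p +ₚ q)) k                    ∎
  where open ≡-Reasoning

ℚ[t]-isCommutativeSemiring : IsCommutativeSemiring _≈ₚ_ _+ₚ_ _*ₚ_ [] 1ₚ
ℚ[t]-isCommutativeSemiring = IsCommutativeSemiringˡ.isCommutativeSemiring (record
  { +-isCommutativeMonoid = commutativeMonoid +ₚ-cong +ₚ-assoc (λ _ → ≈ₚ-refl) +ₚ-comm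
  ; *-isCommutativeMonoid = commutativeMonoid *ₚ-cong *ₚ-assoc *ₚ-identityˡ *ₚ-comm
  ; distribʳ = *ₚ-distribʳ-+ₚ
  ; zeroˡ = λ _ → ≈ₚ-refl })
  where
  commutativeMonoid : ∀ {_∙_ : Poly → Poly → Poly} {e} →
    (∀ {p p′ q q′} → p ≈ₚ p′ → q ≈ₚ q′ → (p ∙ q) ≈ₚ (p′ ∙ q′)) →
    (∀ p q r → (p ∙ q) ∙ r ≈ₚ p ∙ (q ∙ r)) → (∀ p → (e ∙ p) ≈ₚ p) → (∀ p q → (p ∙ q) ≈ₚ (q ∙ p)) →
    IsCommutativeMonoid _≈ₚ_ _∙_ e
  commutativeMonoid {_∙_} {e} ∙-cong assoc identityˡ comm = record
    { isMonoid = record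
      { isSemigroup = record
        { isMagma = record
          { isEquivalence = record { refl = ≈ₚ-refl ; sym = ≈ₚ-sym ; trans = ≈ₚ-trans }
          ; ∙-cong = ∙-cong }
        ; assoc = assoc }
      ; identity = identityˡ , λ p → ≈ₚ-trans (comm p e) (identityˡ p) }
    ; comm = comm }

ℚ[t]-ring : AlmostCommutativeRing _ _
ℚ[t]-ring = record
  { Carrier = Poly ; _≈_ = _≈ₚ_ ; _+_ = _+ₚ_ ; _*_ = _*ₚ_ ; -_ = -ₚ_ ; 0# = [] ; 1# = 1ₚ
  ; 0≟_ = ≈ₚ-zero?
  ; isAlmostCommutativeRing = record
    { isCommutativeSemiring = ℚ[t]-isCommutativeSemiring
    ; -‿cong = scaleₚ-cong (ℚ.- 1ℚ)
    ; -‿*-distribˡ = scaleₚ-*ₚ (ℚ.- 1ℚ)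
    ; -‿+-comm = scaleₚ-+ₚ (ℚ.- 1ℚ) } }
  where
  ≈ₚ-zero? : ∀ p → Maybe ([] ≈ₚ p)
  ≈ₚ-zero? [] = just ≈ₚ-refl
  ≈ₚ-zero? (a ∷ p) with 0ℚ ℚ.≟ a | ≈ₚ-zero? p
  ... | yes 0≡a | just []≈p = just (coeffwise λ { zero → 0≡a ; (suc k) → coeff-≡ []≈p k })
  ... | _       | _         = nothing

ofℚ-* : ∀ a b → ofℚ (a ℚ.* b) ≡ ofℚ a *q ofℚ b
ofℚ-* a b = cong₂ _,_ (re a b) (im a b)
  where
  re : ∀ a b → a ℚ.* b ≡ a ℚ.* b ℚ.- 0ℚ ℚ.* 0ℚ
  re = solve-∀ ℚ-ring
  im : ∀ a b → 0ℚ ≡ a ℚ.* 0ℚ ℚ.+ 0ℚ ℚ.* b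
  im = solve-∀ ℚ-ring

eval-+ₚ : ∀ p q t → eval (p +ₚ q) t ≡ eval p t +q eval q t
eval-+ₚ []      q       t = sym (+q-identityˡ (eval q t))
eval-+ₚ (a ∷ p) []      t = sym (+q-identityʳ (eval (a ∷ p) t))
eval-+ₚ (a ∷ p) (b ∷ q) t = trans (cong (λ w → ofℚ (a ℚ.+ b) +q t *q w) (eval-+ₚ p q t))
  (interchange (ofℚ a) (ofℚ b) t (eval p t) (eval q t))
  where
  interchange : ∀ x y t e f → (x +q y) +q t *q (e +q f) ≡ (x +q t *q e) +q (y +q t *q f)
  interchange = solve-∀ ℚ[i]-ring

eval-scaleₚ : ∀ c p t → eval (scaleₚ c p) t ≡ ofℚ c *q eval p t
eval-scaleₚ c []      t = sym (*q-zeroʳ (ofℚ c))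
eval-scaleₚ c (a ∷ p) t = trans (cong₂ (λ x w → x +q t *q w) (ofℚ-* c a) (eval-scaleₚ c p t))
  (factor (ofℚ c) (ofℚ a) t (eval p t))
  where
  factor : ∀ x y t e → x *q y +q t *q (x *q e) ≡ x *q (y +q t *q e)
  factor = solve-∀ ℚ[i]-ring

eval-*ₚ : ∀ p q t → eval (p *ₚ q) t ≡ eval p t *q eval q t
eval-*ₚ []      q t = sym (*q-zeroˡ (eval q t))
eval-*ₚ (a ∷ p) q t = trans (eval-+ₚ (scaleₚ a q) (0ℚ ∷ p *ₚ q) t)
  (trans (cong₂ (λ x w → x +q (0q +q t *q w)) (eval-scaleₚ a q t) (eval-*ₚ p q t))
         (factor (ofℚ a) (eval q t) t (eval p t)))
  where
  factor : ∀ x e t f → x *q e +q (0q +q t *q (f *q e)) ≡ (x +q t *q f) *q e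
  factor = solve-∀ ℚ[i]-ring

eval-≈ₚ-[] : ∀ q t → [] ≈ₚ q → eval q t ≡ 0q
eval-≈ₚ-[] []      t e = refl
eval-≈ₚ-[] (b ∷ q) t e =
  trans (cong₂ (λ x w → ofℚ x +q t *q w) (sym (coeff-≡ e 0)) (eval-≈ₚ-[] q t (coeffwise λ k → coeff-≡ e (suc k))))
        (vanish t)
  where
  vanish : ∀ t → 0q +q t *q 0q ≡ 0q
  vanish = solve-∀ ℚ[i]-ring

eval-cong : ∀ {p q} t → p ≈ₚ q → eval p t ≡ eval q t
eval-cong {[]}    {q}     t e = sym (eval-≈ₚ-[] q t e)
eval-cong {a ∷ p} {[]}    t e = eval-≈ₚ-[] (a ∷ p) t (≈ₚ-sym e)
eval-cong {a ∷ p} {b ∷ q} t e =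
  cong₂ (λ x w → ofℚ x +q t *q w) (coeff-≡ e 0) (eval-cong {p} {q} t (coeffwise λ k → coeff-≡ e (suc k)))

-- Euclid's algorithm in ℚ[t]

DegreeBelow : Poly → ℕ → Set
DegreeBelow p k = ∀ j → k ≤ j → coeff p j ≡ 0ℚ

degreeBelow-length : ∀ p → DegreeBelow p (length p)
degreeBelow-length []      j       _         = refl
degreeBelow-length (a ∷ p) (suc j) (s≤s k≤j) = degreeBelow-length p j k≤j

Leading : Poly → ℕ → ℕ → Set
Leading p k d = coeff p d ≢ 0ℚ × DegreeBelow p (suc d) × d < k

zero-or-leading : ∀ k p → DegreeBelow p k → ([] ≈ₚ p) ⊎ ∃ (Leading p k)
zero-or-leading zero    p below = inj₁ (coeffwise λ j → sym (below j z≤n))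
zero-or-leading (suc k) p below with coeff p k ℚ.≟ 0ℚ
... | no  ck≢0 = inj₂ (k , ck≢0 , below , ℕ.≤-refl)
... | yes ck≡0 with zero-or-leading k p below′
  where
  below′ : DegreeBelow p k
  below′ j k≤j with ℕ.m≤n⇒m<n∨m≡n k≤j
  ... | inj₁ k<j  = below j k<j
  ... | inj₂ refl = ck≡0
...   | inj₁ p≈0                  = inj₁ p≈0
...   | inj₂ (d , cd≢0 , bd , d<k) = inj₂ (d , cd≢0 , bd , ℕ.m≤n⇒m≤1+n d<k)

monomial : ℕ → ℚ → Poly
monomial zero    c = c ∷ []
monomial (suc j) c = 0ℚ ∷ monomial j c

coeff-monomial-*ₚ : ∀ j c q i → j ≤ i → coeff (monomial j c *ₚ q) i ≡ c ℚ.* coeff q (i ℕ.∸ j)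
coeff-monomial-*ₚ zero    c q i       _         = trans (coeff-≡ (const-*ₚ c q) i) (coeff-scaleₚ c q i)
coeff-monomial-*ₚ (suc j) c q (suc i) (s≤s j≤i) =
  trans (coeff-≡ (0∷-*ₚ (monomial j c) q) (suc i)) (coeff-monomial-*ₚ j c q i j≤i)

_-ₚ_ : Poly → Poly → Poly
p -ₚ q = p +ₚ (-ₚ q)

coeff-subtractₚ : ∀ p q i → coeff (p -ₚ q) i ≡ coeff p i ℚ.- coeff q i
coeff-subtractₚ p q i = trans (coeff-+ₚ p (-ₚ q) i)
  (trans (cong (λ x → coeff p i ℚ.+ x) (coeff-scaleₚ (ℚ.- 1ℚ) q i)) (neg-one (coeff p i) (coeff q i)))
  where
  neg-one : ∀ x y → x ℚ.+ (ℚ.- 1ℚ) ℚ.* y ≡ x ℚ.- y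
  neg-one = solve-∀ ℚ-ring

cancel-leading : ∀ p q dp dq → DegreeBelow p (suc dp) → coeff q dq ≢ 0ℚ → DegreeBelow q (suc dq) →
  dq ≤ dp → ∃ λ M → DegreeBelow (p -ₚ (M *ₚ q)) dp
cancel-leading p q dp dq p<dp+1 lq≢0 q<dq+1 dq≤dp = M , below
  where
  instance _ = ℚ.≢-nonZero lq≢0
  c = coeff p dp ℚ.* ℚ.1/ coeff q dq
  j = dp ℕ.∸ dq
  M = monomial j c
  c*lq≡lp : c ℚ.* coeff q dq ≡ coeff p dp
  c*lq≡lp = trans (ℚ.*-assoc (coeff p dp) (ℚ.1/ coeff q dq) (coeff q dq))
    (trans (cong (coeff p dp ℚ.*_) (ℚ.*-inverseˡ (coeff q dq))) (ℚ.*-identityʳ (coeff p dp)))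
  below : DegreeBelow (p -ₚ (M *ₚ q)) dp
  below i dp≤i with ℕ.m≤n⇒m<n∨m≡n dp≤i
  ... | inj₂ refl = begin
    coeff (p -ₚ (M *ₚ q)) dp                  ≡⟨ coeff-subtractₚ p (M *ₚ q) dp ⟩
    coeff p dp ℚ.- coeff (M *ₚ q) dp          ≡⟨ cong (λ x → coeff p dp ℚ.- x) (coeff-monomial-*ₚ j c q dp (ℕ.m∸n≤m dp dq)) ⟩
    coeff p dp ℚ.- c ℚ.* coeff q (dp ℕ.∸ j)   ≡⟨ cong (λ k → coeff p dp ℚ.- c ℚ.* coeff q k) (ℕ.m∸[m∸n]≡n dq≤dp) ⟩
    coeff p dp ℚ.- c ℚ.* coeff q dq           ≡⟨ cong (λ x → coeff p dp ℚ.- x) c*lq≡lp ⟩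
    coeff p dp ℚ.- coeff p dp                 ≡⟨ ℚ.+-inverseʳ (coeff p dp) ⟩
    0ℚ                                        ∎
    where open ≡-Reasoning
  ... | inj₁ dp<i = begin
    coeff (p -ₚ (M *ₚ q)) i                   ≡⟨ coeff-subtractₚ p (M *ₚ q) i ⟩
    coeff p i ℚ.- coeff (M *ₚ q) i
      ≡⟨ cong₂ ℚ._-_ (p<dp+1 i dp<i) (coeff-monomial-*ₚ j c q i (ℕ.≤-trans (ℕ.m∸n≤m dp dq) dp≤i)) ⟩
    0ℚ ℚ.- c ℚ.* coeff q (i ℕ.∸ j)            ≡⟨ cong (λ x → 0ℚ ℚ.- c ℚ.* x) (q<dq+1 (i ℕ.∸ j) dq<i-j) ⟩
    0ℚ ℚ.- c ℚ.* 0ℚ                           ≡⟨ cong (λ x → 0ℚ ℚ.- x) (ℚ.*-zeroʳ c) ⟩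
    0ℚ                                        ∎
    where
    open ≡-Reasoning
    dq<i-j : dq < i ℕ.∸ j
    dq<i-j = ℕ.+-cancelˡ-< j dq (i ℕ.∸ j)
      (subst₂ _<_ (sym (ℕ.m∸n+n≡m dq≤dp)) (sym (ℕ.m+[n∸m]≡n (ℕ.≤-trans (ℕ.m∸n≤m dp dq) dp≤i))) dp<i)

record BezoutGcd (f g : Poly) : Set where
  constructor bezoutGcd
  field
    h u v f/h g/h : Poly
    h∣f : (f/h *ₚ h) ≈ₚ f
    h∣g : (g/h *ₚ h) ≈ₚ g
    h≈uf+vg : h ≈ₚ ((u *ₚ f) +ₚ (v *ₚ g))

bezoutGcd-zeroʳ : ∀ p q → [] ≈ₚ q → BezoutGcd p q
bezoutGcd-zeroʳ p q q≈0 = bezoutGcd p 1ₚ [] 1ₚ [] (*ₚ-identityˡ p) q≈0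
  (≈ₚ-sym (≈ₚ-trans (+ₚ-identityʳ (1ₚ *ₚ p)) (*ₚ-identityˡ p)))

bezoutGcd-comm : ∀ {p q} → BezoutGcd q p → BezoutGcd p q
bezoutGcd-comm {p} {q} (bezoutGcd h u v q/h p/h h∣q h∣p bez) =
  bezoutGcd h v u p/h q/h h∣p h∣q (≈ₚ-trans bez (+ₚ-comm (u *ₚ q) (v *ₚ p)))

bezoutGcd-reduce : ∀ p M q → BezoutGcd (p -ₚ (M *ₚ q)) q → BezoutGcd p q
bezoutGcd-reduce p M q (bezoutGcd h u v r/h q/h h∣r h∣q bez) =
  bezoutGcd h u (v -ₚ (u *ₚ M)) (r/h +ₚ (M *ₚ q/h)) q/h h∣p h∣q
    (≈ₚ-trans bez (regroup u v p M q))
  where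
  expand : ∀ r/h M q/h h → ((r/h +ₚ (M *ₚ q/h)) *ₚ h) ≈ₚ ((r/h *ₚ h) +ₚ (M *ₚ (q/h *ₚ h)))
  expand = solve-∀ ℚ[t]-ring
  restore : ∀ p M q → p ≈ₚ ((p -ₚ (M *ₚ q)) +ₚ (M *ₚ q))
  restore = solve-∀ ℚ[t]-ring
  regroup : ∀ u v p M q → ((u *ₚ (p -ₚ (M *ₚ q))) +ₚ (v *ₚ q)) ≈ₚ ((u *ₚ p) +ₚ ((v -ₚ (u *ₚ M)) *ₚ q))
  regroup = solve-∀ ℚ[t]-ring
  h∣p : ((r/h +ₚ (M *ₚ q/h)) *ₚ h) ≈ₚ p
  h∣p = ≈ₚ-trans (expand r/h M q/h h) (≈ₚ-trans (+ₚ-cong h∣r (*ₚ-congʳ M h∣q)) (≈ₚ-sym (restore p M q)))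

-- The fuel F bounds the sum of the degree bounds, which drops at every step.
euclid : ∀ F p q bp bq → DegreeBelow p bp → DegreeBelow q bq → bp ℕ.+ bq ≤ F → BezoutGcd p q
euclid F p q bp bq p<bp q<bq bp+bq≤F with zero-or-leading bq q q<bq | zero-or-leading bp p p<bp
... | inj₁ q≈0 | _ = bezoutGcd-zeroʳ p q q≈0
... | inj₂ _ | inj₁ p≈0 = bezoutGcd-comm (bezoutGcd-zeroʳ q p p≈0)
... | inj₂ (dq , lq≢0 , q<dq+1 , dq<bq) | inj₂ (dp , lp≢0 , p<dp+1 , dp<bp)
  with F | bp+bq≤F | ℕ.≤-trans (ℕ.+-monoˡ-< bq dp<bp) bp+bq≤F
...   | suc F′ | bp+bq≤1+F′ | s≤s dp+bq≤F′ with dq ℕ.≤? dp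
...     | yes dq≤dp = let (M , r<dp) = cancel-leading p q dp dq p<dp+1 lq≢0 q<dq+1 dq≤dp in
  bezoutGcd-reduce p M q (euclid F′ (p -ₚ (M *ₚ q)) q dp bq r<dp q<bq dp+bq≤F′)
...     | no  dq≰dp = let (M , r<dq) = cancel-leading q p dq dp q<dq+1 lp≢0 p<dp+1 (ℕ.<⇒≤ (ℕ.≰⇒> dq≰dp)) in
  bezoutGcd-comm (bezoutGcd-reduce q M p (euclid F′ (q -ₚ (M *ₚ p)) p dq bp r<dq p<bp
    (subst (_≤ F′) (ℕ.+-comm bp dq) (ℕ.≤-pred (ℕ.≤-trans (ℕ.+-monoʳ-< bp dq<bq) bp+bq≤1+F′)))))

coprime⇒bezout : ∀ f g → CoprimeP f g → ∃₂ λ u v → ((u *ₚ f) +ₚ (v *ₚ g)) ≈ₚ 1ₚ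
coprime⇒bezout f g coprime = (c ∷ []) *ₚ u , (c ∷ []) *ₚ v ,
  ≈ₚ-trans (factor (c ∷ []) u f v g) (≈ₚ-trans (*ₚ-congʳ (c ∷ []) (≈ₚ-sym h≈uf+vg)) c*h≈1)
  where
  open BezoutGcd (euclid _ f g (length f) (length g) (degreeBelow-length f) (degreeBelow-length g) ℕ.≤-refl)
  unit : IsUnitₚ h
  unit = coprime h (f/h , coeff-≡ h∣f) (g/h , coeff-≡ h∣g)
  instance _ = ℚ.≢-nonZero (proj₁ unit)
  c = ℚ.1/ coeff h 0
  c*h≈1 : ((c ∷ []) *ₚ h) ≈ₚ 1ₚ
  c*h≈1 = ≈ₚ-trans (const-*ₚ c h) (coeffwise λ
    { zero    → trans (coeff-scaleₚ c h 0) (ℚ.*-inverseˡ (coeff h 0))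
    ; (suc k) → trans (coeff-scaleₚ c h (suc k)) (trans (cong (c ℚ.*_) (proj₂ unit (suc k) (s≤s z≤n))) (ℚ.*-zeroʳ c)) })
  factor : ∀ c u f v g → (((c *ₚ u) *ₚ f) +ₚ ((c *ₚ v) *ₚ g)) ≈ₚ (c *ₚ ((u *ₚ f) +ₚ (v *ₚ g)))
  factor = solve-∀ ℚ[t]-ring

eval-bezout : ∀ u v f g → ((u *ₚ f) +ₚ (v *ₚ g)) ≈ₚ 1ₚ → ∀ t →
  eval u t *q eval f t +q eval v t *q eval g t ≡ 1q
eval-bezout u v f g bez t = begin
  eval u t *q eval f t +q eval v t *q eval g t  ≡⟨ cong₂ _+q_ (eval-*ₚ u f t) (eval-*ₚ v g t) ⟨
  eval (u *ₚ f) t +q eval (v *ₚ g) t            ≡⟨ eval-+ₚ (u *ₚ f) (v *ₚ g) t ⟨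
  eval ((u *ₚ f) +ₚ (v *ₚ g)) t                 ≡⟨ eval-cong t bez ⟩
  eval 1ₚ t                                     ≡⟨ trans (cong (1q +q_) (*q-zeroʳ t)) (+q-identityʳ 1q) ⟩
  1q                                            ∎
  where open ≡-Reasoning

-- Euclid's algorithm in ℤ[i]

-- The norm as an integer, where the ring solver applies.
normℤ : ℤi → ℤ
normℤ (x , y) = x ℤ.* x ℤ.+ y ℤ.* y

∣x∣²≡x² : ∀ x → + (ℤ.∣ x ∣ ℕ.* ℤ.∣ x ∣) ≡ x ℤ.* x
∣x∣²≡x² (+ n)    = ℤ.pos-* n n
∣x∣²≡x² -[1+ n ] = trans (ℤ.pos-* (suc n) (suc n)) (square-neg (+ suc n))
  where
  square-neg : ∀ x → x ℤ.* x ≡ ℤ.- x ℤ.* ℤ.- x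
  square-neg = solve-∀ ℤ-ring

Nᵢ≡normℤ : ∀ z → + Nᵢ z ≡ normℤ z
Nᵢ≡normℤ (x , y) = trans (ℤ.pos-+ (ℤ.∣ x ∣ ℕ.* ℤ.∣ x ∣) (ℤ.∣ y ∣ ℕ.* ℤ.∣ y ∣)) (cong₂ ℤ._+_ (∣x∣²≡x² x) (∣x∣²≡x² y))

Nᵢ-* : ∀ w z → Nᵢ (w *ᵢ z) ≡ Nᵢ w ℕ.* Nᵢ z
Nᵢ-* w@(a , b) z@(c , d) = ℤ.+-injective (begin
  + Nᵢ (w *ᵢ z)              ≡⟨ Nᵢ≡normℤ (w *ᵢ z) ⟩
  normℤ (w *ᵢ z)             ≡⟨ brahmagupta a b c d ⟩
  normℤ w ℤ.* normℤ z        ≡⟨ cong₂ ℤ._*_ (Nᵢ≡normℤ w) (Nᵢ≡normℤ z) ⟨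
  + Nᵢ w ℤ.* + Nᵢ z          ≡⟨ ℤ.pos-* (Nᵢ w) (Nᵢ z) ⟨
  + (Nᵢ w ℕ.* Nᵢ z)          ∎)
  where
  open ≡-Reasoning
  brahmagupta : ∀ a b c d → (a ℤ.* c ℤ.- b ℤ.* d) ℤ.* (a ℤ.* c ℤ.- b ℤ.* d) ℤ.+ (a ℤ.* d ℤ.+ b ℤ.* c) ℤ.* (a ℤ.* d ℤ.+ b ℤ.* c)
              ≡ (a ℤ.* a ℤ.+ b ℤ.* b) ℤ.* (c ℤ.* c ℤ.+ d ℤ.* d)
  brahmagupta = solve-∀ ℤ-ring

Nᵢ-^ : ∀ w k → Nᵢ (w ^ᵢ k) ≡ Nᵢ w ℕ.^ k
Nᵢ-^ w zero    = refl
Nᵢ-^ w (suc k) = trans (Nᵢ-* w (w ^ᵢ k)) (cong (Nᵢ w ℕ.*_) (Nᵢ-^ w k))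

Nᵢ≡0⇒≡0ᵢ : ∀ z → Nᵢ z ≡ 0 → z ≡ 0ᵢ
Nᵢ≡0⇒≡0ᵢ (x , y) N≡0 = cong₂ _,_ (square≡0 x (ℕ.m+n≡0⇒m≡0 _ N≡0)) (square≡0 y (ℕ.m+n≡0⇒n≡0 (ℤ.∣ x ∣ ℕ.* ℤ.∣ x ∣) N≡0))
  where
  square≡0 : ∀ x → ℤ.∣ x ∣ ℕ.* ℤ.∣ x ∣ ≡ 0 → x ≡ + 0
  square≡0 x e with ℕ.m*n≡0⇒m≡0∨n≡0 ℤ.∣ x ∣ e
  ... | inj₁ ∣x∣≡0 = ℤ.∣i∣≡0⇒i≡0 ∣x∣≡0
  ... | inj₂ ∣x∣≡0 = ℤ.∣i∣≡0⇒i≡0 ∣x∣≡0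

conjᵢ : ℤi → ℤi
conjᵢ (x , y) = (x , ℤ.- y)

conjᵢ-*-self : ∀ z → conjᵢ z *ᵢ z ≡ (normℤ z , + 0)
conjᵢ-*-self (x , y) = cong₂ _,_ (re x y) (im x y)
  where
  re : ∀ x y → x ℤ.* x ℤ.- ℤ.- y ℤ.* y ≡ x ℤ.* x ℤ.+ y ℤ.* y
  re = solve-∀ ℤ-ring
  im : ∀ x y → x ℤ.* y ℤ.+ ℤ.- y ℤ.* x ≡ + 0
  im = solve-∀ ℤ-ring

-- Nearest-integer division: 2x + N = ρ + q·2N with 0 ≤ ρ < 2N, and then
-- 4(x − qN)² + ρ(2N − ρ) = N² bounds the error, both summands being nonnegative.
round : ∀ (x : ℤ) (k : ℕ) → ∃ λ q → 4 ℕ.* (ℤ.∣ x ℤ.- q ℤ.* + suc k ∣ ℕ.* ℤ.∣ x ℤ.- q ℤ.* + suc k ∣) ≤ suc k ℕ.* suc k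
round x k = q , subst (4 ℕ.* (ℤ.∣ e ∣ ℕ.* ℤ.∣ e ∣) ≤_) (ℤ.+-injective exact) (ℕ.m≤m+n _ (ρ ℕ.* σ))
  where
  N = suc k
  cancel : ∀ a b → a ℤ.+ b ℤ.- b ≡ a
  cancel = solve-∀ ℤ-ring
  X = + 2 ℤ.* x ℤ.+ + N
  q = X ℤ./ + (2 ℕ.* N)
  ρ = X ℤ.% + (2 ℕ.* N)
  σ = 2 ℕ.* N ℕ.∸ ρ
  e = x ℤ.- q ℤ.* + N
  division : X ≡ + ρ ℤ.+ q ℤ.* (+ 2 ℤ.* + N)
  division = trans (ℤ.a≡a%n+[a/n]*n X (+ (2 ℕ.* N))) (cong (λ w → + ρ ℤ.+ q ℤ.* w) (ℤ.pos-* 2 N))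
  σ+ρ : + σ ℤ.+ + ρ ≡ + 2 ℤ.* + N
  σ+ρ = trans (sym (ℤ.pos-+ σ ρ)) (trans (cong +_ (ℕ.m∸n+n≡m (ℕ.<⇒≤ (ℤ.n%d<d X (+ (2 ℕ.* N)))))) (ℤ.pos-* 2 N))
  ρ≡2e+N : + ρ ≡ + 2 ℤ.* e ℤ.+ + N
  ρ≡2e+N = begin
    + ρ                                          ≡⟨ cancel (+ ρ) (q ℤ.* (+ 2 ℤ.* + N)) ⟨
    + ρ ℤ.+ q ℤ.* (+ 2 ℤ.* + N) ℤ.- q ℤ.* (+ 2 ℤ.* + N)  ≡⟨ cong (ℤ._- q ℤ.* (+ 2 ℤ.* + N)) division ⟨
    X ℤ.- q ℤ.* (+ 2 ℤ.* + N)                    ≡⟨ regroup x q (+ N) ⟩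
    + 2 ℤ.* e ℤ.+ + N                            ∎
    where
    open ≡-Reasoning
    regroup : ∀ x q N → + 2 ℤ.* x ℤ.+ N ℤ.- q ℤ.* (+ 2 ℤ.* N) ≡ + 2 ℤ.* (x ℤ.- q ℤ.* N) ℤ.+ N
    regroup = solve-∀ ℤ-ring
  σ≡N-2e : + σ ≡ + N ℤ.- + 2 ℤ.* e
  σ≡N-2e = begin
    + σ                                  ≡⟨ cancel (+ σ) (+ ρ) ⟨
    + σ ℤ.+ + ρ ℤ.- + ρ                  ≡⟨ cong₂ ℤ._-_ σ+ρ ρ≡2e+N ⟩
    + 2 ℤ.* + N ℤ.- (+ 2 ℤ.* e ℤ.+ + N)  ≡⟨ regroup e (+ N) ⟩
    + N ℤ.- + 2 ℤ.* e                    ∎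
    where
    open ≡-Reasoning
    regroup : ∀ e N → + 2 ℤ.* N ℤ.- (+ 2 ℤ.* e ℤ.+ N) ≡ N ℤ.- + 2 ℤ.* e
    regroup = solve-∀ ℤ-ring
  exact : + (4 ℕ.* (ℤ.∣ e ∣ ℕ.* ℤ.∣ e ∣) ℕ.+ ρ ℕ.* σ) ≡ + (N ℕ.* N)
  exact = begin
    + (4 ℕ.* (ℤ.∣ e ∣ ℕ.* ℤ.∣ e ∣) ℕ.+ ρ ℕ.* σ)
      ≡⟨ ℤ.pos-+ _ (ρ ℕ.* σ) ⟩
    + (4 ℕ.* (ℤ.∣ e ∣ ℕ.* ℤ.∣ e ∣)) ℤ.+ + (ρ ℕ.* σ)
      ≡⟨ cong₂ ℤ._+_ (trans (ℤ.pos-* 4 (ℤ.∣ e ∣ ℕ.* ℤ.∣ e ∣)) (cong (+ 4 ℤ.*_) (∣x∣²≡x² e))) (ℤ.pos-* ρ σ) ⟩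
    + 4 ℤ.* (e ℤ.* e) ℤ.+ + ρ ℤ.* + σ
      ≡⟨ cong₂ (λ r s → + 4 ℤ.* (e ℤ.* e) ℤ.+ r ℤ.* s) ρ≡2e+N σ≡N-2e ⟩
    + 4 ℤ.* (e ℤ.* e) ℤ.+ (+ 2 ℤ.* e ℤ.+ + N) ℤ.* (+ N ℤ.- + 2 ℤ.* e)
      ≡⟨ square-completion e (+ N) ⟩
    + N ℤ.* + N
      ≡⟨ ℤ.pos-* N N ⟨
    + (N ℕ.* N) ∎
    where
    open ≡-Reasoning
    square-completion : ∀ e N → + 4 ℤ.* (e ℤ.* e) ℤ.+ (+ 2 ℤ.* e ℤ.+ N) ℤ.* (N ℤ.- + 2 ℤ.* e) ≡ N ℤ.* N
    square-completion = solve-∀ ℤ-ring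

infixl 6 _-ᵢ_

_-ᵢ_ : ℤi → ℤi → ℤi
w -ᵢ z = w +ᵢ (-ᵢ z)

Nᵢ-conjᵢ : ∀ z → Nᵢ (conjᵢ z) ≡ Nᵢ z
Nᵢ-conjᵢ (x , y) = cong (λ n → ℤ.∣ x ∣ ℕ.* ℤ.∣ x ∣ ℕ.+ n ℕ.* n) (ℤ.∣-i∣≡∣i∣ y)

-- Divide a·b̄ by N(b) coordinatewise with rounding; the error is r·b̄ where r = a − q·b.
divMod : ∀ a b k → Nᵢ b ≡ suc k → ∃ λ q → Nᵢ (a -ᵢ q *ᵢ b) < Nᵢ b
divMod a b k Nb≡N = q , subst (Nᵢ r <_) (sym Nb≡N) (half⇒< (Nᵢ r) 2Nr≤N)
  where
  N = suc k
  x = proj₁ (a *ᵢ conjᵢ b)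
  y = proj₂ (a *ᵢ conjᵢ b)
  q₁ = proj₁ (round x k)
  q₂ = proj₁ (round y k)
  q = (q₁ , q₂)
  r = a -ᵢ q *ᵢ b
  e₁ = x ℤ.- q₁ ℤ.* + N
  e₂ = y ℤ.- q₂ ℤ.* + N
  b̄b≡N : conjᵢ b *ᵢ b ≡ (+ N , + 0)
  b̄b≡N = trans (conjᵢ-*-self b) (cong (_, + 0) (trans (sym (Nᵢ≡normℤ b)) (cong +_ Nb≡N)))
  rb̄≡e : r *ᵢ conjᵢ b ≡ (e₁ , e₂)
  rb̄≡e = begin
    r *ᵢ conjᵢ b                              ≡⟨ distribute a q b (conjᵢ b) ⟩
    a *ᵢ conjᵢ b -ᵢ q *ᵢ (conjᵢ b *ᵢ b)       ≡⟨ cong (λ w → a *ᵢ conjᵢ b -ᵢ q *ᵢ w) b̄b≡N ⟩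
    (x , y) -ᵢ (q₁ , q₂) *ᵢ (+ N , + 0)       ≡⟨ cong₂ _,_ (re x q₁ q₂ (+ N)) (im y q₁ q₂ (+ N)) ⟩
    (e₁ , e₂)                                 ∎
    where
    open ≡-Reasoning
    distribute : ∀ a q b c → (a +ᵢ -ᵢ (q *ᵢ b)) *ᵢ c ≡ a *ᵢ c +ᵢ -ᵢ (q *ᵢ (c *ᵢ b))
    distribute = solve-∀ ℤ[i]-ring
    re : ∀ x q₁ q₂ N → x ℤ.+ ℤ.- (q₁ ℤ.* N ℤ.- q₂ ℤ.* + 0) ≡ x ℤ.- q₁ ℤ.* N
    re = solve-∀ ℤ-ring
    im : ∀ y q₁ q₂ N → y ℤ.+ ℤ.- (q₁ ℤ.* + 0 ℤ.+ q₂ ℤ.* N) ≡ y ℤ.- q₂ ℤ.* N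
    im = solve-∀ ℤ-ring
  Nr*N≡e² : Nᵢ r ℕ.* N ≡ ℤ.∣ e₁ ∣ ℕ.* ℤ.∣ e₁ ∣ ℕ.+ ℤ.∣ e₂ ∣ ℕ.* ℤ.∣ e₂ ∣
  Nr*N≡e² = begin
    Nᵢ r ℕ.* N                ≡⟨ cong (Nᵢ r ℕ.*_) (trans (sym Nb≡N) (sym (Nᵢ-conjᵢ b))) ⟩
    Nᵢ r ℕ.* Nᵢ (conjᵢ b)     ≡⟨ Nᵢ-* r (conjᵢ b) ⟨
    Nᵢ (r *ᵢ conjᵢ b)         ≡⟨ cong Nᵢ rb̄≡e ⟩
    Nᵢ (e₁ , e₂)              ∎
    where open ≡-Reasoning
  4NrN≤2NN : 4 ℕ.* Nᵢ r ℕ.* N ≤ 2 ℕ.* N ℕ.* N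
  4NrN≤2NN = begin
    4 ℕ.* Nᵢ r ℕ.* N                  ≡⟨ ℕ.*-assoc 4 (Nᵢ r) N ⟩
    4 ℕ.* (Nᵢ r ℕ.* N)                ≡⟨ cong (4 ℕ.*_) Nr*N≡e² ⟩
    4 ℕ.* (ℤ.∣ e₁ ∣ ℕ.* ℤ.∣ e₁ ∣ ℕ.+ ℤ.∣ e₂ ∣ ℕ.* ℤ.∣ e₂ ∣)
      ≡⟨ ℕ.*-distribˡ-+ 4 (ℤ.∣ e₁ ∣ ℕ.* ℤ.∣ e₁ ∣) (ℤ.∣ e₂ ∣ ℕ.* ℤ.∣ e₂ ∣) ⟩
    4 ℕ.* (ℤ.∣ e₁ ∣ ℕ.* ℤ.∣ e₁ ∣) ℕ.+ 4 ℕ.* (ℤ.∣ e₂ ∣ ℕ.* ℤ.∣ e₂ ∣)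
      ≤⟨ ℕ.+-mono-≤ (proj₂ (round x k)) (proj₂ (round y k)) ⟩
    N ℕ.* N ℕ.+ N ℕ.* N               ≡⟨ double N ⟩
    2 ℕ.* N ℕ.* N                     ∎
    where
    open ℕ.≤-Reasoning
    double : ∀ n → n ℕ.* n ℕ.+ n ℕ.* n ≡ 2 ℕ.* n ℕ.* n
    double = ℕ-solve-∀
  2Nr≤N : 2 ℕ.* Nᵢ r ≤ N
  2Nr≤N = ℕ.*-cancelˡ-≤ 2 (subst (_≤ 2 ℕ.* N) (ℕ.*-assoc 2 2 (Nᵢ r)) (ℕ.*-cancelʳ-≤ (4 ℕ.* Nᵢ r) (2 ℕ.* N) N 4NrN≤2NN))
  half⇒< : ∀ m → 2 ℕ.* m ≤ N → m < N
  half⇒< zero    _      = s≤s z≤n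
  half⇒< (suc m) 2m≤N = ℕ.<-≤-trans (ℕ.m<m+n (suc m) (s≤s z≤n))
    (subst (_≤ N) (cong (suc m ℕ.+_) (ℕ.+-identityʳ (suc m))) 2m≤N)

record BezoutGcdᵢ (a b : ℤi) : Set where
  constructor bezoutGcdᵢ
  field
    g x y a/g b/g : ℤi
    g∣a : a/g *ᵢ g ≡ a
    g∣b : b/g *ᵢ g ≡ b
    g≡xa+yb : g ≡ x *ᵢ a +ᵢ y *ᵢ b

bezoutGcdᵢ-zeroʳ : ∀ a → BezoutGcdᵢ a 0ᵢ
bezoutGcdᵢ-zeroʳ a = bezoutGcdᵢ a 1ᵢ 0ᵢ 1ᵢ 0ᵢ (*ᵢ-identityˡ a) (*ᵢ-zeroˡ a) (sym (project a))
  where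
  project : ∀ a → 1ᵢ *ᵢ a +ᵢ 0ᵢ *ᵢ 0ᵢ ≡ a
  project = solve-∀ ℤ[i]-ring

bezoutGcdᵢ-reduce : ∀ a b q → BezoutGcdᵢ b (a -ᵢ q *ᵢ b) → BezoutGcdᵢ a b
bezoutGcdᵢ-reduce a b q (bezoutGcdᵢ g x y b/g r/g g∣b g∣r bez) =
  bezoutGcdᵢ g y (x -ᵢ y *ᵢ q) (q *ᵢ b/g +ᵢ r/g) b/g g∣a g∣b (trans bez (regroup x y a b q))
  where
  g∣a : (q *ᵢ b/g +ᵢ r/g) *ᵢ g ≡ a
  g∣a = begin
    (q *ᵢ b/g +ᵢ r/g) *ᵢ g           ≡⟨ expand q b/g r/g g ⟩
    q *ᵢ (b/g *ᵢ g) +ᵢ r/g *ᵢ g      ≡⟨ cong₂ (λ u v → q *ᵢ u +ᵢ v) g∣b g∣r ⟩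
    q *ᵢ b +ᵢ (a +ᵢ -ᵢ (q *ᵢ b))     ≡⟨ cancel a (q *ᵢ b) ⟩
    a                                ∎
    where
    open ≡-Reasoning
    expand : ∀ q b/g r/g g → (q *ᵢ b/g +ᵢ r/g) *ᵢ g ≡ q *ᵢ (b/g *ᵢ g) +ᵢ r/g *ᵢ g
    expand = solve-∀ ℤ[i]-ring
    cancel : ∀ a w → w +ᵢ (a +ᵢ -ᵢ w) ≡ a
    cancel = solve-∀ ℤ[i]-ring
  regroup : ∀ x y a b q → x *ᵢ b +ᵢ y *ᵢ (a +ᵢ -ᵢ (q *ᵢ b)) ≡ y *ᵢ a +ᵢ (x +ᵢ -ᵢ (y *ᵢ q)) *ᵢ b
  regroup = solve-∀ ℤ[i]-ring

-- The fuel F bounds N(b), which drops at every step.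
euclidᵢ : ∀ F a b n → Nᵢ b ≡ n → n < F → BezoutGcdᵢ a b
euclidᵢ F       a b zero    Nb≡0 _ = subst (BezoutGcdᵢ a) (sym (Nᵢ≡0⇒≡0ᵢ b Nb≡0)) (bezoutGcdᵢ-zeroʳ a)
euclidᵢ (suc F) a b (suc k) Nb≡ (s≤s k<F) =
  let q , Nr<Nb = divMod a b k Nb≡
      r = a -ᵢ q *ᵢ b
  in bezoutGcdᵢ-reduce a b q (euclidᵢ F b r (Nᵢ r) refl (ℕ.<-≤-trans (subst (Nᵢ r <_) Nb≡ Nr<Nb) k<F))

coprime⇒1∈⟨⟩ : ∀ a b → CoprimeI a b → 1ᵢ ∈⟨ a , b ⟩
coprime⇒1∈⟨⟩ a b coprime = ḡ *ᵢ x , ḡ *ᵢ y , (begin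
  1ᵢ                             ≡⟨ cong (_, + 0) (trans (cong +_ (sym unit)) (Nᵢ≡normℤ g)) ⟩
  (normℤ g , + 0)                ≡⟨ conjᵢ-*-self g ⟨
  ḡ *ᵢ g                         ≡⟨ cong (ḡ *ᵢ_) g≡xa+yb ⟩
  ḡ *ᵢ (x *ᵢ a +ᵢ y *ᵢ b)        ≡⟨ distribute ḡ x a y b ⟩
  ḡ *ᵢ x *ᵢ a +ᵢ ḡ *ᵢ y *ᵢ b     ∎)
  where
  open ≡-Reasoning
  open BezoutGcdᵢ (euclidᵢ (suc (Nᵢ b)) a b (Nᵢ b) refl (ℕ.n<1+n (Nᵢ b)))
  ḡ = conjᵢ g
  unit : Nᵢ g ≡ 1
  unit = coprime g (a/g , g∣a) (b/g , g∣b)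
  distribute : ∀ c x a y b → c *ᵢ (x *ᵢ a +ᵢ y *ᵢ b) ≡ c *ᵢ x *ᵢ a +ᵢ c *ᵢ y *ᵢ b
  distribute = solve-∀ ℤ[i]-ring

-- Homogenisation

ι-ofℤ-* : ∀ x y → ι (ofℤ (x ℤ.* y)) ≡ ι (ofℤ x) *q ι (ofℤ y)
ι-ofℤ-* x y = trans (cong ofℚ (ℤ→ℚ-* x y)) (ofℚ-* (ℤ→ℚ x) (ℤ→ℚ y))

↧*≡↥ : ∀ c → ι (ofℤ (ℚ.↧ c)) *q ofℚ c ≡ ι (ofℤ (ℚ.↥ c))
↧*≡↥ c@record{} = trans (sym (ofℚ-* (ℤ→ℚ (ℚ.↧ c)) c)) (cong ofℚ (ℚ.toℚᵘ-injective
  (ℚᵘ.≃-trans (ℚ.toℚᵘ-homo-* (ℤ→ℚ (ℚ.↧ c)) c)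
  (ℚᵘ.≃-trans (ℚᵘ.*-cong (toℚᵘ-ℤ→ℚ (ℚ.↧ c)) (ℚᵘ.≃-refl {ℚ.toℚᵘ c}))
  (ℚᵘ.≃-trans (ℚᵘ.*≡* (trans (swap (ℚ.↥ c) (ℚ.↧ c)) (cong (λ w → ℚ.↥ c ℤ.* + w) (sym (ℕ.*-identityˡ (ℚ.↧ₙ c))))))
  (ℚᵘ.≃-sym (toℚᵘ-ℤ→ℚ (ℚ.↥ c))))))))
  where
  swap : ∀ x d → (d ℤ.* x) ℤ.* + 1 ≡ x ℤ.* d
  swap = solve-∀ ℤ-ring

den : Poly → ℕ
den []      = 1
den (c ∷ p) = ℚ.↧ₙ c ℕ.* den p

cleared-leading : Poly → ℕ → ℤi
cleared-leading h r = ofℤ (ℚ.↥ (coeff h r)) *ᵢ ofℤ (+ den h)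

ι-den-∷ : ∀ c p → ι (ofℤ (+ den (c ∷ p))) ≡ ι (ofℤ (ℚ.↧ c)) *q ι (ofℤ (+ den p))
ι-den-∷ c p = trans (cong (λ z → ι (ofℤ z)) (ℤ.pos-* (ℚ.↧ₙ c) (den p))) (ι-ofℤ-* (ℚ.↧ c) (+ den p))

-- For t = α/β, the value βᴷ·p(t) of the degree-K homogenisation of p is integral
-- up to the denominator of p, and is congruent to its leading term modulo β.
homogenise : ∀ {t α β} → t *q β ≡ α → Integral α → Integral β → ∀ p K → DegreeBelow p (suc K) →
  ∃ λ P → Integral P ×
    (ι (ofℤ (+ den p)) *q (β ^q K *q eval p t) ≡ ι (ofℤ (+ den p)) *q ofℚ (coeff p K) *q α ^q K +q β *q P)
homogenise {t} {α} {β} _ _ _ [] K _ = 0q , Integral-ι 0ᵢ , vanish (β ^q K) (α ^q K) β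
  where
  vanish : ∀ x y β → 1q *q (x *q 0q) ≡ 1q *q 0q *q y +q β *q 0q
  vanish = solve-∀ ℚ[i]-ring
homogenise {t} {α} {β} _ _ _ (c ∷ p) zero p<1 = 0q , Integral-ι 0ᵢ , (begin
  D *q (1q *q (ofℚ c +q t *q eval p t))  ≡⟨ cong (λ w → D *q (1q *q (ofℚ c +q t *q w))) p[t]≡0 ⟩
  D *q (1q *q (ofℚ c +q t *q 0q))        ≡⟨ constant D (ofℚ c) t β ⟩
  D *q ofℚ c *q 1q +q β *q 0q            ∎)
  where
  open ≡-Reasoning
  D = ι (ofℤ (+ den (c ∷ p)))
  p[t]≡0 : eval p t ≡ 0q
  p[t]≡0 = eval-≈ₚ-[] p t (coeffwise λ k → sym (p<1 (suc k) (s≤s z≤n)))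
  constant : ∀ D c t β → D *q (1q *q (c +q t *q 0q)) ≡ D *q c *q 1q +q β *q 0q
  constant = solve-∀ ℚ[i]-ring
homogenise {t} {α} {β} tβ≡α iα iβ (c ∷ p) (suc K) p<K+2
  with homogenise tβ≡α iα iβ p K (λ j K<j → p<K+2 (suc j) (s≤s K<j))
... | P′ , iP′ , IH = P , iP , (begin
  D *q (β *q β ^q K *q (ofℚ c +q t *q eval p t))
    ≡⟨ cong (_*q (β *q β ^q K *q (ofℚ c +q t *q eval p t))) (ι-den-∷ c p) ⟩
  d *q D′ *q (β *q β ^q K *q (ofℚ c +q t *q eval p t))
    ≡⟨ expand d D′ β (β ^q K) (ofℚ c) t (eval p t) ⟩
  d *q ofℚ c *q D′ *q β *q β ^q K +q d *q (t *q β) *q (D′ *q (β ^q K *q eval p t))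
    ≡⟨ cong₂ (λ u v → u *q D′ *q β *q β ^q K +q d *q v *q (D′ *q (β ^q K *q eval p t))) (↧*≡↥ c) tβ≡α ⟩
  n *q D′ *q β *q β ^q K +q d *q α *q (D′ *q (β ^q K *q eval p t))
    ≡⟨ cong (λ w → n *q D′ *q β *q β ^q K +q d *q α *q w) IH ⟩
  n *q D′ *q β *q β ^q K +q d *q α *q (D′ *q ofℚ cₖ *q α ^q K +q β *q P′)
    ≡⟨ collect d D′ (ofℚ cₖ) α (α ^q K) β P′ n (β ^q K) ⟩
  d *q D′ *q ofℚ cₖ *q (α *q α ^q K) +q β *q P
    ≡⟨ cong (λ w → w *q ofℚ cₖ *q (α *q α ^q K) +q β *q P) (ι-den-∷ c p) ⟨
  D *q ofℚ cₖ *q (α *q α ^q K) +q β *q P ∎)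
  where
  open ≡-Reasoning
  D = ι (ofℤ (+ den (c ∷ p)))
  D′ = ι (ofℤ (+ den p))
  d = ι (ofℤ (ℚ.↧ c))
  n = ι (ofℤ (ℚ.↥ c))
  cₖ = coeff p K
  P = n *q D′ *q β ^q K +q d *q α *q P′
  iP : Integral P
  iP = Integral-+ (Integral-* (Integral-* (Integral-ι (ofℤ (ℚ.↥ c))) (Integral-ι (ofℤ (+ den p)))) (Integral-^ K iβ))
                  (Integral-* (Integral-* (Integral-ι (ofℤ (ℚ.↧ c))) iα) iP′)
  expand : ∀ d D′ β βᴷ c t e → d *q D′ *q (β *q βᴷ *q (c +q t *q e))
         ≡ d *q c *q D′ *q β *q βᴷ +q d *q (t *q β) *q (D′ *q (βᴷ *q e))
  expand = solve-∀ ℚ[i]-ring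
  collect : ∀ d D′ c α αᴷ β P′ n βᴷ → n *q D′ *q β *q βᴷ +q d *q α *q (D′ *q c *q αᴷ +q β *q P′)
          ≡ d *q D′ *q c *q (α *q αᴷ) +q β *q (n *q D′ *q βᴷ +q d *q α *q P′)
  collect = solve-∀ ℚ[i]-ring

bezout-factor : Poly → Poly → ℤi
bezout-factor U V = ofℤ (+ den U) *ᵢ ofℤ (+ den V)

bezout-exponent : ℕ → ℕ → Poly → Poly → ℕ
bezout-exponent m′ n U V = suc m′ ℕ.* (length U ℕ.+ length V) ℕ.+ n ℕ.* 10

module _ (m′ : ℕ) (a b : ℤi) (t : ℚi) (t*bᵐ≡a : t *q ι b ^q suc m′ ≡ ι a) where

  private
    α β : ℚi
    α = ι a
    β = ι b ^q suc m′
    iα : Integral α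
    iα = Integral-ι a
    iβ : Integral β
    iβ = Integral-^ (suc m′) (Integral-ι b)
    D : Poly → ℚi
    D p = ι (ofℤ (+ den p))

  homogenise-length : ∀ p → ∃ λ P → Integral P × (D p *q (β ^q length p *q eval p t) ≡ β *q P)
  homogenise-length p with homogenise t*bᵐ≡a iα iβ p (length p) (λ j K<j → degreeBelow-length p j (ℕ.<⇒≤ K<j))
  ... | P , iP , eq = P , iP , (begin
    D p *q (β ^q length p *q eval p t)
      ≡⟨ eq ⟩
    D p *q ofℚ (coeff p (length p)) *q α ^q length p +q β *q P
      ≡⟨ cong (λ c → D p *q ofℚ c *q α ^q length p +q β *q P) (degreeBelow-length p (length p) ℕ.≤-refl) ⟩
    D p *q 0q *q α ^q length p +q β *q P
      ≡⟨ drop (D p) (α ^q length p) β P ⟩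
    β *q P ∎)
    where
    open ≡-Reasoning
    drop : ∀ D x β P → D *q 0q *q x +q β *q P ≡ β *q P
    drop = solve-∀ ℚ[i]-ring

  -- Clearing denominators in u(t)·f(t) + v(t)·g(t) = 1.
  bezout-multiple∈⟨A,B⟩ : ∀ {f g n A B} U V → ((U *ₚ f) +ₚ (V *ₚ g)) ≈ₚ 1ₚ →
    ι A ≡ Aof f n b t → ι B ≡ Bof g n b t →
    bezout-factor U V *ᵢ b ^ᵢ bezout-exponent m′ n U V ∈⟨ A , B ⟩
  bezout-multiple∈⟨A,B⟩ {f} {g} {n} {A} {B} U V bez A≡ B≡ = ∈⟨⟩-ι ip iq (begin
    ι (bezout-factor U V *ᵢ b ^ᵢ E)
      ≡⟨ trans (ι-* (bezout-factor U V) (b ^ᵢ E))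
               (cong₂ _*q_ (ι-* (ofℤ (+ den U)) (ofℤ (+ den V))) (ι-^ b E)) ⟩
    D U *q D V *q ι b ^q E
      ≡⟨ cong (D U *q D V *q_) bᴱ≡W ⟩
    D U *q D V *q (β ^q K₁ *q β ^q K₂ *q (u ^q 4 *q u ^q 6))
      ≡⟨ *q-identityʳ _ ⟨
    D U *q D V *q (β ^q K₁ *q β ^q K₂ *q (u ^q 4 *q u ^q 6)) *q 1q
      ≡⟨ cong (D U *q D V *q (β ^q K₁ *q β ^q K₂ *q (u ^q 4 *q u ^q 6)) *q_) (eval-bezout U V f g bez t) ⟨
    D U *q D V *q (β ^q K₁ *q β ^q K₂ *q (u ^q 4 *q u ^q 6)) *q (eval U t *q eval f t +q eval V t *q eval g t)
      ≡⟨ distribute (D U) (D V) (β ^q K₁) (β ^q K₂) (u ^q 4) (u ^q 6) (eval U t) (eval V t) (eval f t) (eval g t) ⟩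
    D U *q (β ^q K₁ *q eval U t) *q (u ^q 4 *q eval f t) *q (D V *q β ^q K₂ *q u ^q 6)
      +q D V *q (β ^q K₂ *q eval V t) *q (u ^q 6 *q eval g t) *q (D U *q β ^q K₁ *q u ^q 4)
      ≡⟨ cong₄ eqU (sym A≡) eqV (sym B≡) ⟩
    β *q P₁ *q ι A *q (D V *q β ^q K₂ *q u ^q 6) +q β *q P₂ *q ι B *q (D U *q β ^q K₁ *q u ^q 4)
      ≡⟨ regroup (β *q P₁) (ι A) (D V *q β ^q K₂ *q u ^q 6) (β *q P₂) (ι B) (D U *q β ^q K₁ *q u ^q 4) ⟩
    p *q ι A +q q *q ι B ∎)
    where
    open ≡-Reasoning
    P₁ = proj₁ (homogenise-length U)
    iP₁ = proj₁ (proj₂ (homogenise-length U))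
    eqU = proj₂ (proj₂ (homogenise-length U))
    P₂ = proj₁ (homogenise-length V)
    iP₂ = proj₁ (proj₂ (homogenise-length V))
    eqV = proj₂ (proj₂ (homogenise-length V))
    K₁ = length U
    K₂ = length V
    E = suc m′ ℕ.* (K₁ ℕ.+ K₂) ℕ.+ n ℕ.* 10
    u = ι b ^q n
    p = β *q P₁ *q (D V *q β ^q K₂ *q u ^q 6)
    q = β *q P₂ *q (D U *q β ^q K₁ *q u ^q 4)
    ip : Integral p
    ip = Integral-* (Integral-* iβ iP₁)
      (Integral-* (Integral-* (Integral-ι (ofℤ (+ den V))) (Integral-^ K₂ iβ)) (Integral-^ 6 (Integral-^ n (Integral-ι b))))
    iq : Integral q
    iq = Integral-* (Integral-* iβ iP₂)
      (Integral-* (Integral-* (Integral-ι (ofℤ (+ den U))) (Integral-^ K₁ iβ)) (Integral-^ 4 (Integral-^ n (Integral-ι b))))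
    bᴱ≡W : ι b ^q E ≡ β ^q K₁ *q β ^q K₂ *q (u ^q 4 *q u ^q 6)
    bᴱ≡W = begin
      ι b ^q (suc m′ ℕ.* (K₁ ℕ.+ K₂) ℕ.+ n ℕ.* 10)    ≡⟨ ^q-homo-* (ι b) (suc m′ ℕ.* (K₁ ℕ.+ K₂)) (n ℕ.* 10) ⟩
      ι b ^q (suc m′ ℕ.* (K₁ ℕ.+ K₂)) *q ι b ^q (n ℕ.* 10)
        ≡⟨ cong₂ _*q_ (sym (^q-assocʳ (ι b) (suc m′) (K₁ ℕ.+ K₂))) (sym (^q-assocʳ (ι b) n 10)) ⟩
      β ^q (K₁ ℕ.+ K₂) *q u ^q (4 ℕ.+ 6)       ≡⟨ cong₂ _*q_ (^q-homo-* β K₁ K₂) (^q-homo-* u 4 6) ⟩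
      β ^q K₁ *q β ^q K₂ *q (u ^q 4 *q u ^q 6)  ∎
    distribute : ∀ Dᵤ Dᵥ βᵤ βᵥ u⁴ u⁶ eᵤ eᵥ e₁ e₂ →
      Dᵤ *q Dᵥ *q (βᵤ *q βᵥ *q (u⁴ *q u⁶)) *q (eᵤ *q e₁ +q eᵥ *q e₂)
      ≡ Dᵤ *q (βᵤ *q eᵤ) *q (u⁴ *q e₁) *q (Dᵥ *q βᵥ *q u⁶) +q Dᵥ *q (βᵥ *q eᵥ) *q (u⁶ *q e₂) *q (Dᵤ *q βᵤ *q u⁴)
    distribute = solve-∀ ℚ[i]-ring
    cong₄ : ∀ {x x′ y y′ z z′ w w′} → x ≡ x′ → y ≡ y′ → z ≡ z′ → w ≡ w′ →
      x *q y *q (D V *q β ^q K₂ *q u ^q 6) +q z *q w *q (D U *q β ^q K₁ *q u ^q 4)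
      ≡ x′ *q y′ *q (D V *q β ^q K₂ *q u ^q 6) +q z′ *q w′ *q (D U *q β ^q K₁ *q u ^q 4)
    cong₄ refl refl refl refl = refl
    regroup : ∀ x A y z B w → x *q A *q y +q z *q B *q w ≡ (x *q y) *q A +q (z *q w) *q B
    regroup = solve-∀ ℚ[i]-ring

  leading-multiple∈⟨Y,b⟩ : ∀ {h r n e Y} → HasDegree h r → n ℕ.* e ≡ suc m′ ℕ.* r →
    ι Y ≡ (ι b ^q n) ^q e *q eval h t → cleared-leading h r *ᵢ a ^ᵢ r ∈⟨ Y , b ⟩
  leading-multiple∈⟨Y,b⟩ {h} {r} {n} {e} {Y} (_ , h<r+1) ne≡mr Y≡ = ∈⟨⟩-ι ip iq (begin
    ι (cleared-leading h r *ᵢ a ^ᵢ r)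
      ≡⟨ trans (ι-* (cleared-leading h r) (a ^ᵢ r)) (cong₂ _*q_ (ι-* (ofℤ (ℚ.↥ c)) (ofℤ (+ den h))) (ι-^ a r)) ⟩
    N *q D h *q α ^q r
      ≡⟨ cancel (N *q D h *q α ^q r) (β *q (d *q P)) ⟨
    N *q D h *q α ^q r +q β *q (d *q P) +q -q (β *q (d *q P))
      ≡⟨ cong (_+q -q (β *q (d *q P))) dDY≡ ⟨
    d *q D h *q ι Y +q -q (β *q (d *q P))
      ≡⟨ split (d *q D h) (ι Y) (ι b) (ι b ^q m′) (d *q P) ⟩
    d *q D h *q ι Y +q -q (ι b ^q m′ *q (d *q P)) *q ι b ∎)
    where
    open ≡-Reasoning
    c = coeff h r
    d = ι (ofℤ (ℚ.↧ c))
    N = ι (ofℤ (ℚ.↥ c))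
    H = homogenise t*bᵐ≡a iα iβ h r h<r+1
    P = proj₁ H
    ip : Integral (d *q D h)
    ip = Integral-* (Integral-ι (ofℤ (ℚ.↧ c))) (Integral-ι (ofℤ (+ den h)))
    iq : Integral (-q (ι b ^q m′ *q (d *q P)))
    iq = Integral-neg (Integral-* (Integral-^ m′ (Integral-ι b)) (Integral-* (Integral-ι (ofℤ (ℚ.↧ c))) (proj₁ (proj₂ H))))
    dDY≡ : d *q D h *q ι Y ≡ N *q D h *q α ^q r +q β *q (d *q P)
    dDY≡ = begin
      d *q D h *q ι Y                                  ≡⟨ cong (d *q D h *q_) Y≡ ⟩
      d *q D h *q ((ι b ^q n) ^q e *q eval h t)         ≡⟨ cong (λ w → d *q D h *q (w *q eval h t)) bⁿᵉ≡βʳ ⟩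
      d *q D h *q (β ^q r *q eval h t)                 ≡⟨ *q-assoc d (D h) (β ^q r *q eval h t) ⟩
      d *q (D h *q (β ^q r *q eval h t))               ≡⟨ cong (d *q_) (proj₂ (proj₂ H)) ⟩
      d *q (D h *q ofℚ c *q α ^q r +q β *q P)          ≡⟨ regroup d (D h) (ofℚ c) (α ^q r) β P ⟩
      d *q ofℚ c *q D h *q α ^q r +q β *q (d *q P)     ≡⟨ cong (λ w → w *q D h *q α ^q r +q β *q (d *q P)) (↧*≡↥ c) ⟩
      N *q D h *q α ^q r +q β *q (d *q P)              ∎
      where
      bⁿᵉ≡βʳ : (ι b ^q n) ^q e ≡ β ^q r
      bⁿᵉ≡βʳ = trans (^q-assocʳ (ι b) n e) (trans (cong (ι b ^q_) ne≡mr) (sym (^q-assocʳ (ι b) (suc m′) r)))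
      regroup : ∀ d D c x β P → d *q (D *q c *q x +q β *q P) ≡ d *q c *q D *q x +q β *q (d *q P)
      regroup = solve-∀ ℚ[i]-ring
    cancel : ∀ x y → x +q y +q -q y ≡ x
    cancel = solve-∀ ℚ[i]-ring
    split : ∀ dD Y b bᵐ′ Q → dD *q Y +q -q ((b *q bᵐ′) *q Q) ≡ dD *q Y +q -q (bᵐ′ *q Q) *q b
    split = solve-∀ ℚ[i]-ring

-- A fixed element of every ideal (A³, B²)

1ᵢ^ : ∀ k → 1ᵢ ^ᵢ k ≡ 1ᵢ
1ᵢ^ zero    = refl
1ᵢ^ (suc k) = trans (cong (1ᵢ *ᵢ_) (1ᵢ^ k)) (*ᵢ-identityˡ 1ᵢ)

∈⟨⟩-cancel-unit : ∀ {a b c Y} r → 1ᵢ ∈⟨ a , b ⟩ → c *ᵢ a ^ᵢ r ∈⟨ Y , b ⟩ → c ∈⟨ Y , b ⟩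
∈⟨⟩-cancel-unit {a} {b} {c} {Y} r 1∈⟨a,b⟩ caʳ∈⟨Y,b⟩ = ∈⟨⟩-comm (subst (_∈⟨ b , Y ⟩) c*1ʳ≡c
  (∈⟨⟩-replace c (∈⟨⟩-^ r (∈⟨⟩-comm 1∈⟨a,b⟩)) (∈⟨⟩-comm caʳ∈⟨Y,b⟩)))
  where
  c*1ʳ≡c : c *ᵢ 1ᵢ ^ᵢ r ≡ c
  c*1ʳ≡c = trans (cong (c *ᵢ_) (1ᵢ^ r)) (*ᵢ-identityʳ c)

∈⟨⟩-^⁶ : ∀ {z x y} → z ∈⟨ x , y ⟩ → z ^ᵢ 6 ∈⟨ x ^ᵢ 3 , y ^ᵢ 2 ⟩
∈⟨⟩-^⁶ {z} z∈⟨x,y⟩ = ∈⟨⟩-comm (subst (_∈⟨ _ , _ ⟩) (^ᵢ-assocʳ z 2 3) (∈⟨⟩-^ 3 (∈⟨⟩-comm (∈⟨⟩-^ 2 z∈⟨x,y⟩))))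

-- As c ≡ q·b modulo Z, (cᵏ)ᴱ is a multiple of bᴱ modulo Zᵏ.
∈⟨⟩-trade : ∀ {b c s Z Z′} k E → c ∈⟨ Z , b ⟩ → s *ᵢ b ^ᵢ E ∈⟨ Z ^ᵢ k , Z′ ⟩ → s *ᵢ (c ^ᵢ k) ^ᵢ E ∈⟨ Z ^ᵢ k , Z′ ⟩
∈⟨⟩-trade {s = s} k E c∈⟨Z,b⟩ sbᴱ∈ = ∈⟨⟩-replace s (∈⟨⟩-^ E (∈⟨⟩-comm (∈⟨⟩-^ k (∈⟨⟩-comm c∈⟨Z,b⟩)))) sbᴱ∈

∈⟨⟩-∣ : ∀ {d z x y} → d ∣ᵢ x → d ∣ᵢ y → z ∈⟨ x , y ⟩ → d ∣ᵢ z
∈⟨⟩-∣ {d} (x/d , refl) (y/d , refl) (p , q , refl) = p *ᵢ x/d +ᵢ q *ᵢ y/d , factor p x/d q y/d d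
  where
  factor : ∀ p x q y d → (p *ᵢ x +ᵢ q *ᵢ y) *ᵢ d ≡ p *ᵢ (x *ᵢ d) +ᵢ q *ᵢ (y *ᵢ d)
  factor = solve-∀ ℤ[i]-ring

*ᵢ-≢0 : ∀ {x y} → x ≢ 0ᵢ → y ≢ 0ᵢ → x *ᵢ y ≢ 0ᵢ
*ᵢ-≢0 {x} {y} x≢0 y≢0 xy≡0 with ℕ.m*n≡0⇒m≡0∨n≡0 (Nᵢ x) (trans (sym (Nᵢ-* x y)) (cong Nᵢ xy≡0))
... | inj₁ Nx≡0 = x≢0 (Nᵢ≡0⇒≡0ᵢ x Nx≡0)
... | inj₂ Ny≡0 = y≢0 (Nᵢ≡0⇒≡0ᵢ y Ny≡0)

^ᵢ-≢0 : ∀ {x} k → x ≢ 0ᵢ → x ^ᵢ k ≢ 0ᵢ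
^ᵢ-≢0 zero    x≢0 ()
^ᵢ-≢0 (suc k) x≢0 = *ᵢ-≢0 x≢0 (^ᵢ-≢0 k x≢0)

ofℤ-≢0 : ∀ {z} → z ≢ + 0 → ofℤ z ≢ 0ᵢ
ofℤ-≢0 z≢0 = z≢0 ∘ cong proj₁

den-≢0 : ∀ p → ofℤ (+ den p) ≢ 0ᵢ
den-≢0 p = ofℤ-≢0 (ℕ.≢-nonZero⁻¹ (den p) {{den-nonZero p}} ∘ ℤ.+-injective)
  where
  den-nonZero : ∀ p → ℕ.NonZero (den p)
  den-nonZero []      = _
  den-nonZero (c ∷ p) = ℕ.m*n≢0 (ℚ.↧ₙ c) (den p) {{_}} {{den-nonZero p}}

cleared-leading-≢0 : ∀ h r → coeff h r ≢ 0ℚ → cleared-leading h r ≢ 0ᵢ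
cleared-leading-≢0 h r c≢0 = *ᵢ-≢0 (ofℤ-≢0 (c≢0 ∘ ℚ.↥p≡0⇒p≡0 (coeff h r))) (den-≢0 h)

-- S₃ without its size conditions, with m = suc m′. A record rather than a Σ-type, so that
-- A and B can be inferred: unification cannot see through the arithmetic of ℤ[i] and ℚ[i].
record Arising (f g : Poly) (n m′ : ℕ) (A B : ℤi) : Set where
  constructor arising
  field
    a b : ℤi
    a⊥b : CoprimeI a b
    t : ℚi
    t*bᵐ≡a : t *q ι b ^q suc m′ ≡ ι a
    A≡ : ι A ≡ Aof f n b t
    B≡ : ι B ≡ Bof g n b t

constant∈⟨A³,B²⟩ : ∀ f g r s n m′ → HasDegree f r → HasDegree g s → CoprimeP f g →
  n ℕ.* 4 ≡ suc m′ ℕ.* r ⊎ n ℕ.* 6 ≡ suc m′ ℕ.* s →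
  ∃ λ T → T ≢ 0ᵢ × (∀ {A B} → Arising f g n m′ A B → T ∈⟨ A ^ᵢ 3 , B ^ᵢ 2 ⟩)
constant∈⟨A³,B²⟩ f g r s n m′ hf hg coprime = [ via-f , via-g ]′
  where
  U = proj₁ (coprime⇒bezout f g coprime)
  V = proj₁ (proj₂ (coprime⇒bezout f g coprime))
  R≢0 : bezout-factor U V ≢ 0ᵢ
  R≢0 = *ᵢ-≢0 (den-≢0 U) (den-≢0 V)
  bezout-multiple⁶∈⟨A³,B²⟩ : ∀ a b t {A B} → t *q ι b ^q suc m′ ≡ ι a → ι A ≡ Aof f n b t → ι B ≡ Bof g n b t →
    bezout-factor U V ^ᵢ 6 *ᵢ b ^ᵢ (bezout-exponent m′ n U V ℕ.* 6) ∈⟨ A ^ᵢ 3 , B ^ᵢ 2 ⟩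
  bezout-multiple⁶∈⟨A³,B²⟩ a b t {A} {B} t*bᵐ≡a A≡ B≡ = subst (_∈⟨ A ^ᵢ 3 , B ^ᵢ 2 ⟩)
    (trans (^ᵢ-distrib-* (bezout-factor U V) (b ^ᵢ bezout-exponent m′ n U V) 6)
           (cong (bezout-factor U V ^ᵢ 6 *ᵢ_) (^ᵢ-assocʳ b (bezout-exponent m′ n U V) 6)))
    (∈⟨⟩-^⁶ {bezout-factor U V *ᵢ b ^ᵢ bezout-exponent m′ n U V} {A} {B}
      (bezout-multiple∈⟨A,B⟩ m′ a b t t*bᵐ≡a {f} {g} {n} {A} {B} U V (proj₂ (proj₂ (coprime⇒bezout f g coprime))) A≡ B≡))
  via-f : n ℕ.* 4 ≡ suc m′ ℕ.* r → ∃ λ T → T ≢ 0ᵢ × (∀ {A B} → Arising f g n m′ A B → T ∈⟨ A ^ᵢ 3 , B ^ᵢ 2 ⟩)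
  via-f 4n≡mr =
    bezout-factor U V ^ᵢ 6 *ᵢ (cleared-leading f r ^ᵢ 3) ^ᵢ (bezout-exponent m′ n U V ℕ.* 6) ,
    *ᵢ-≢0 (^ᵢ-≢0 6 R≢0) (^ᵢ-≢0 (bezout-exponent m′ n U V ℕ.* 6) (^ᵢ-≢0 3 (cleared-leading-≢0 f r (proj₁ hf)))) ,
    λ {A} {B} (arising a b a⊥b t t*bᵐ≡a A≡ B≡) →
      ∈⟨⟩-trade {b} {cleared-leading f r} {bezout-factor U V ^ᵢ 6} {A} {B ^ᵢ 2} 3 (bezout-exponent m′ n U V ℕ.* 6)
        (∈⟨⟩-cancel-unit {a} {b} {cleared-leading f r} {A} r (coprime⇒1∈⟨⟩ a b a⊥b)
          (leading-multiple∈⟨Y,b⟩ m′ a b t t*bᵐ≡a {f} {r} {n} {4} {A} hf 4n≡mr A≡))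
        (bezout-multiple⁶∈⟨A³,B²⟩ a b t {A} {B} t*bᵐ≡a A≡ B≡)
  via-g : n ℕ.* 6 ≡ suc m′ ℕ.* s → ∃ λ T → T ≢ 0ᵢ × (∀ {A B} → Arising f g n m′ A B → T ∈⟨ A ^ᵢ 3 , B ^ᵢ 2 ⟩)
  via-g 6n≡ms =
    bezout-factor U V ^ᵢ 6 *ᵢ (cleared-leading g s ^ᵢ 2) ^ᵢ (bezout-exponent m′ n U V ℕ.* 6) ,
    *ᵢ-≢0 (^ᵢ-≢0 6 R≢0) (^ᵢ-≢0 (bezout-exponent m′ n U V ℕ.* 6) (^ᵢ-≢0 2 (cleared-leading-≢0 g s (proj₁ hg)))) ,
    λ {A} {B} (arising a b a⊥b t t*bᵐ≡a A≡ B≡) → ∈⟨⟩-comm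
      (∈⟨⟩-trade {b} {cleared-leading g s} {bezout-factor U V ^ᵢ 6} {B} {A ^ᵢ 3} 2 (bezout-exponent m′ n U V ℕ.* 6)
        (∈⟨⟩-cancel-unit {a} {b} {cleared-leading g s} {B} s (coprime⇒1∈⟨⟩ a b a⊥b)
          (leading-multiple∈⟨Y,b⟩ m′ a b t t*bᵐ≡a {g} {s} {n} {6} {B} hg 6n≡ms B≡))
        (∈⟨⟩-comm (bezout-multiple⁶∈⟨A³,B²⟩ a b t {A} {B} t*bᵐ≡a A≡ B≡)))

-- Counting the fibre

∣ᵢ⇒Nᵢ≤ : ∀ {d z} → d ∣ᵢ z → z ≢ 0ᵢ → Nᵢ d ≤ Nᵢ z
∣ᵢ⇒Nᵢ≤ {d} (q , refl) qd≢0 = subst (Nᵢ d ≤_) (sym (Nᵢ-* q d)) (ℕ.m≤n*m (Nᵢ d) (Nᵢ q) {{ℕ.≢-nonZero Nq≢0}})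
  where
  Nq≢0 : Nᵢ q ≢ 0
  Nq≢0 Nq≡0 = qd≢0 (subst (λ x → x *ᵢ d ≡ 0ᵢ) (sym (Nᵢ≡0⇒≡0ᵢ q Nq≡0)) (*ᵢ-zeroˡ d))

m≤m^[1+n] : ∀ m n → m ≤ m ℕ.^ suc n
m≤m^[1+n] zero    n = z≤n
m≤m^[1+n] (suc m) n = ℕ.m≤m*n (suc m) (suc m ℕ.^ n) {{ℕ.m^n≢0 (suc m) n}}

integers≤ : ℕ → List ℤ
integers≤ B = applyUpTo +_ (suc B) ++ applyUpTo -[1+_] B

∈-integers≤ : ∀ {z B} → ℤ.∣ z ∣ ≤ B → z ∈ integers≤ B
∈-integers≤ {+ k}      k≤B = ∈-++⁺ˡ (∈-applyUpTo⁺ +_ (s≤s k≤B))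
∈-integers≤ { -[1+ k ]} k<B = ∈-++⁺ʳ (applyUpTo +_ _) (∈-applyUpTo⁺ -[1+_] k<B)

gaussians≤ : ℕ → List ℤi
gaussians≤ B = cartesianProduct (integers≤ B) (integers≤ B)

∈-gaussians≤ : ∀ {z B} → Nᵢ z ≤ B → z ∈ gaussians≤ B
∈-gaussians≤ {x , y} Nz≤B = ∈-cartesianProduct⁺
  (∈-integers≤ (ℕ.≤-trans (m≤m*m ℤ.∣ x ∣) (ℕ.≤-trans (ℕ.m≤m+n _ _) Nz≤B)))
  (∈-integers≤ (ℕ.≤-trans (m≤m*m ℤ.∣ y ∣) (ℕ.≤-trans (ℕ.m≤n+m _ _) Nz≤B)))
  where
  m≤m*m : ∀ m → m ≤ m ℕ.* m
  m≤m*m zero    = z≤n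
  m≤m*m (suc m) = ℕ.m≤m*n (suc m) (suc m)

module _ {A : Set} where

  ∈-─ : ∀ {x y} {ys : List A} (x∈ys : x ∈ ys) → y ∈ ys → y ≢ x → y ∈ (ys ─ x∈ys)
  ∈-─ (here refl) (here refl) y≢x = ⊥-elim (y≢x refl)
  ∈-─ (here refl) (there y∈ys) _  = y∈ys
  ∈-─ (there _)   (here refl)  _  = here refl
  ∈-─ (there x∈ys) (there y∈ys) y≢x = there (∈-─ x∈ys y∈ys y≢x)

  unique-⊆⇒length≤ : ∀ {xs ys : List A} → Unique xs → (∀ {x} → x ∈ xs → x ∈ ys) → length xs ≤ length ys
  unique-⊆⇒length≤ {[]}     _              _    = z≤n
  unique-⊆⇒length≤ {x ∷ xs} {ys} (x∉xs ∷ unique) xs⊆ys =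
    subst (suc (length xs) ≤_) (sym (length-removeAt′ ys (index x∈ys)))
      (s≤s (unique-⊆⇒length≤ unique λ y∈xs → ∈-─ x∈ys (xs⊆ys (there y∈xs)) (≢-sym (All.lookup x∉xs y∈xs))))
    where
    x∈ys = xs⊆ys (here refl)

/-cross : ∀ r n k m′ → (+ r) ℚ./ suc k ≡ (+ n) ℚ./ suc m′ → n ℕ.* suc k ≡ suc m′ ℕ.* r
/-cross r n k m′ e with ℚ./-injective-≃ (ℚᵘ.mkℚᵘ (+ r) k) (ℚᵘ.mkℚᵘ (+ n) m′) e
... | ℚᵘ.*≡* r*m≡n*k =
  trans (ℤ.+-injective (trans (ℤ.pos-* n (suc k)) (trans (sym r*m≡n*k) (sym (ℤ.pos-* r (suc m′))))))
        (ℕ.*-comm r (suc m′))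

⊔-case : ∀ r s n m′ → ((+ r) ℚ./ 4) ℚ.⊔ ((+ s) ℚ./ 6) ≡ (+ n) ℚ./ suc m′ →
  n ℕ.* 4 ≡ suc m′ ℕ.* r ⊎ n ℕ.* 6 ≡ suc m′ ℕ.* s
⊔-case r s n m′ e with ℚ.≤-total ((+ r) ℚ./ 4) ((+ s) ℚ./ 6)
... | inj₁ r/4≤s/6 = inj₂ (/-cross s n 5 m′ (trans (sym (ℚ.p≤q⇒p⊔q≡q r/4≤s/6)) e))
... | inj₂ s/6≤r/4 = inj₁ (/-cross r n 3 m′ (trans (sym (ℚ.p≥q⇒p⊔q≡p s/6≤r/4)) e))

ι-discᵢ : ∀ A B → ι (discᵢ A B) ≡ discq (ι A) (ι B)
ι-discᵢ A B = trans (ι-+ (ofℤ (+ 4) *ᵢ A ^ᵢ 3) (ofℤ (+ 27) *ᵢ B ^ᵢ 2))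
  (cong₂ _+q_ (trans (ι-* (ofℤ (+ 4)) (A ^ᵢ 3)) (cong (ι (ofℤ (+ 4)) *q_) (ι-^ A 3)))
              (trans (ι-* (ofℤ (+ 27)) (B ^ᵢ 2)) (cong (ι (ofℤ (+ 27)) *q_) (ι-^ B 2))))

module _ {f g : Poly} {n m′ : ℕ} {κ X : ℚ} {D : ℤi → ℤi → ℤi}
         (largest : ∀ A B → discᵢ A B ≢ 0ᵢ → Largest12 A B (D A B))
         {T : ℤi} (T≢0 : T ≢ 0ᵢ) (T∈ : ∀ {A B} → Arising f g n m′ A B → T ∈⟨ A ^ᵢ 3 , B ^ᵢ 2 ⟩) where

  fibre⊆ : ∀ {A′ B′ A B} → InS₃ f g n (suc m′) κ X A B → MapsTo D (A , B) (A′ , B′) →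
    (A , B) ∈ map (λ d → d ^ᵢ 4 *ᵢ A′ , d ^ᵢ 6 *ᵢ B′) (gaussians≤ (Nᵢ T))
  fibre⊆ {A′} {B′} {A} {B} (a , b , (a⊥b , _ , _ , _ , disc≢0) , t , t*bᵐ≡a , A≡ , B≡) (A≡d⁴A′ , B≡d⁶B′) =
    subst (_∈ _) (sym (cong₂ _,_ A≡d⁴A′ B≡d⁶B′))
      (∈-map⁺ (λ d → d ^ᵢ 4 *ᵢ A′ , d ^ᵢ 6 *ᵢ B′)
        (∈-gaussians≤ {d} {Nᵢ T} (ℕ.≤-trans (m≤m^[1+n] (Nᵢ d) 11) Nd¹²≤NT)))
    where
    d = D A B
    discᵢ≢0 : discᵢ A B ≢ 0ᵢ
    discᵢ≢0 disc≡0 = disc≢0 t t*bᵐ≡a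
      (trans (cong₂ discq (sym A≡) (sym B≡)) (trans (sym (ι-discᵢ A B)) (cong ι disc≡0)))
    Nd¹²≤NT : Nᵢ d ℕ.^ 12 ≤ Nᵢ T
    Nd¹²≤NT = subst (_≤ Nᵢ T) (Nᵢ-^ d 12) (∣ᵢ⇒Nᵢ≤ {d ^ᵢ 12} {T}
      (∈⟨⟩-∣ {d ^ᵢ 12} {T} {A ^ᵢ 3} {B ^ᵢ 2} (proj₁ (largest A B discᵢ≢0)) (proj₁ (proj₂ (largest A B discᵢ≢0)))
        (T∈ {A} {B} (arising a b a⊥b t t*bᵐ≡a A≡ B≡))) T≢0)

lemma4p9 : (f g : Poly) (r s n m : ℕ) .{{_ : NonZero m}} →
    HasDegree f r → HasDegree g s → CoprimeP f g → (0 ℕ.< r ⊎ 0 ℕ.< s) →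
    0 ℕ.< n → Coprime n m → (n ≡ 1 ⊎ m ≡ 1) →
    ((+ r) ℚ./ 4) ℚ.⊔ ((+ s) ℚ./ 6) ≡ (+ n) ℚ./ m →
    (κ : ℚ) → ℚ.0ℚ ℚ.< κ →
    (∀ X → ℚ.0ℚ ℚ.< X → ∀ a b → CoprimeI a b → b ≢ 0ᵢ →
      ℕ→ℚ (Nᵢ a) ^ℚ (12 ℕ.* n) ℚ.< (κ ^ℚ (12 ℕ.* n)) ℚ.* (X ^ℚ m) →
      ℕ→ℚ (Nᵢ b) ^ℚ (12 ℕ.* n) ℚ.< (κ ^ℚ (12 ℕ.* n)) ℚ.* X →
      ∀ t → t *q (ι b ^q m) ≡ ι a →
      (Nq (Aof f n b t) ^ℚ 3 ℚ.< X) × (Nq (Bof g n b t) ^ℚ 2 ℚ.< X)) →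
    (D : ℤi → ℤi → ℤi) → (∀ A B → discᵢ A B ≢ 0ᵢ → Largest12 A B (D A B)) →
    ∃ λ N → (0 ℕ.< N) ×
      (∀ X → ℚ.0ℚ ℚ.< X → ∀ A' B' → InS f g X A' B' →
        (L : List (ℤi × ℤi)) → Unique L →
        All (λ p → InS₃ f g n m κ X (proj₁ p) (proj₂ p) × MapsTo D p (A' , B')) L →
        length L ℕ.≤ N)
lemma4p9 f g r s n (suc m′) hf hg coprime _ _ _ _ max≡n/m κ _ _ D largest =
  suc (length candidates) , s≤s z≤n , λ X _ A′ B′ _ L unique fibre →
    ℕ.m≤n⇒m≤1+n (subst (length L ≤_) (length-map (λ d → d ^ᵢ 4 *ᵢ A′ , d ^ᵢ 6 *ᵢ B′) candidates)
      (unique-⊆⇒length≤ unique λ {(A , B)} p∈L →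
        fibre⊆ {f} {g} {n} {m′} {κ} {X} {D} largest {T} T≢0 T∈ {A′} {B′} {A} {B}
          (proj₁ (All.lookup fibre p∈L)) (proj₂ (All.lookup fibre p∈L))))
  where
  T-data = constant∈⟨A³,B²⟩ f g r s n m′ hf hg coprime (⊔-case r s n m′ max≡n/m)
  T = proj₁ T-data
  T≢0 = proj₁ (proj₂ T-data)
  T∈ = proj₂ (proj₂ T-data)
  candidates = gaussians≤ (Nᵢ T)
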